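{- For every positive integer $n$ there is a bijection $\phi_n:\mathfrak{S}_{n-1}\times\{0,1,\dots,n-1\}\to\mathfrak{S}_n$ such that for all $\sigma\in\mathfrak{S}_{n-1}$ and $0\leq c\leq n-1$: $$\mathsf{Exc}(\phi_n(\sigma,c))=\begin{cases}\mathsf{Exc}(\sigma),& 0\leq c\leq\mathsf{exc}(\sigma),\\ \mathsf{Exc}(\sigma)\cup\{k_d\},&\text{otherwise,}\end{cases}\qquad \mathsf{den}(\phi_n(\sigma,c))=\mathsf{den}(\sigma)+c,$$ where $d=c-\mathsf{exc}(\sigma)$ and $k_d$ is the $d$-th smallest non-excedance of $\sigma$ (i.e., the $d$-th smallest element of $\{i\in[n-1]:\sigma_i\leq i\}$).
   Context: $\mathfrak{S}_m$ is the set of permutations of $[m]$ in one-line notation. A position $i$ is an excedance of $\sigma$ if $\sigma_i>i$, and a non-excedance otherwise; $\mathsf{Exc}(\sigma)$ is the set of excedances and $\mathsf{exc}(\sigma)=|\mathsf{Exc}(\sigma)|$. For a word $u$ of distinct integers, $\mathsf{inv}(u)$ counts pairs of positions $i<j$ with $u_i>u_j$. Denert's statistic: $\mathsf{den}(\sigma)=\sum_{i\in\mathsf{Exc}(\sigma)}i+\mathsf{inv}(\mathrm{EXCL}(\sigma))+\mathsf{inv}(\mathrm{NEXCL}(\sigma))$, where $\mathrm{EXCL}(\sigma)$ is the subsequence of letters $\sigma_i$ with $i\in\mathsf{Exc}(\sigma)$ and $\mathrm{NEXCL}(\sigma)$ the subsequence of the remaining letters. -}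

module Defs where

open import Data.Nat using (ℕ; zero; suc; _+_; _<_; _≤_; _∸_)
open import Data.Nat.Properties using (_<?_; _≤?_)
open import Data.Fin using (Fin; toℕ)
open import Data.Fin.Permutation using (Permutation′; _⟨$⟩ʳ_)
open import Data.List using (List; []; _∷_; map; filter; allFin; length)
open import Data.Nat.ListAction using (sum)
open import Data.Maybe using (Maybe; just; nothing)

-- Position i : Fin m stands for the integer toℕ i + 1, and the value
-- π(i) for toℕ (π ⟨$⟩ʳ i) + 1 (one-line notation, 1-based).

excFin : ∀ {m} → Permutation′ m → List (Fin m)
excFin {m} π = filter (λ i → toℕ i <? toℕ (π ⟨$⟩ʳ i)) (allFin m)

nexcFin : ∀ {m} → Permutation′ m → List (Fin m)
nexcFin {m} π = filter (λ i → toℕ (π ⟨$⟩ʳ i) ≤? toℕ i) (allFin m)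

Exc : ∀ {m} → Permutation′ m → List ℕ
Exc π = map (λ i → suc (toℕ i)) (excFin π)

NExc : ∀ {m} → Permutation′ m → List ℕ
NExc π = map (λ i → suc (toℕ i)) (nexcFin π)

exc : ∀ {m} → Permutation′ m → ℕ
exc π = length (Exc π)

EXCL : ∀ {m} → Permutation′ m → List ℕ
EXCL π = map (λ i → suc (toℕ (π ⟨$⟩ʳ i))) (excFin π)

NEXCL : ∀ {m} → Permutation′ m → List ℕ
NEXCL π = map (λ i → suc (toℕ (π ⟨$⟩ʳ i))) (nexcFin π)

inv : List ℕ → ℕ
inv [] = 0
inv (x ∷ xs) = length (filter (_<? x) xs) + inv xs

den : ∀ {m} → Permutation′ m → ℕ
den π = sum (Exc π) + inv (EXCL π) + inv (NEXCL π)

nth : List ℕ → ℕ → Maybe ℕ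
nth [] _ = nothing
nth (x ∷ xs) zero = just x
nth (x ∷ xs) (suc k) = nth xs k

{-# OPTIONS --safe #-}
-- Insert the new maximum m into σ at a position p and push the letter it
-- displaces to the right: at each later position the carried letter is
-- exchanged with the letter there exactly when both are excedance letters or
-- both are not, and the last carried letter lands at the new last position.
-- Every position other than p keeps its excedance status, and p becomes or
-- stays an excedance.  Counting the carried letter as the next excedance letter,
-- the inversions in den do not change along the scan; when it becomes a
-- non-excedance letter, moving it to the non-excedance letters changes nothing
-- either, because the letters form a permutation.  So den grows by one plus the
-- number of excedances after p if p is an excedance, and by p plus that number
-- (1-based) otherwise; taking for p the end, the c-th excedance from the right,
-- or the (c − exc σ)-th non-excedance makes the increment c.  The scan can be
-- run backwards from the position of m, which recovers σ; and c ↦ p is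
-- injective, since c is the increment of den, hence bijective by pigeonhole.
module Submission where

open import Defs
import Algebra.Properties.CommutativeMonoid.Sum as FinSum
open import Data.Bool using (Bool; true; false; if_then_else_; not)
open import Data.Empty using (⊥; ⊥-elim)
open import Data.Fin using (Fin; toℕ; fromℕ; fromℕ<; inject₁; punchIn; punchOut; zero; suc)
open import Data.Fin.Permutation
  using (Permutation′; _⟨$⟩ʳ_; _⟨$⟩ˡ_; _≈_; _∘ₚ_; flip; permutation; inverseˡ;
         insert; remove; insert-punchIn; insert-remove; punchIn-permute)
open import Data.Fin.Properties
  using (_≟_; any?; toℕ-injective; toℕ-inject₁; toℕ-fromℕ; toℕ-fromℕ<; toℕ<n;
         punchOut-injective; injective⇒≤)
open import Data.List as List using (List; []; _∷_; _++_; _∷ʳ_; length; map; filter)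
open import Data.List.Membership.Propositional using (_∈_)
import Data.List.Properties as Listₚ
open import Data.List.Properties
  using (length-++; length-map; ++-assoc; ++-identityʳ; map-++; map-∘; map-tabulate;
         ∷ʳ-++; ∷ʳ-injective; filter-accept; filter-reject)
open import Data.List.Relation.Unary.All as All using (All; []; _∷_)
import Data.List.Relation.Unary.All.Properties as All
open import Data.List.Relation.Unary.Any using (here; there)
import Data.List.Relation.Unary.Any.Properties as Any
open import Data.Maybe using (just; fromMaybe)
open import Data.Nat using (ℕ; zero; suc; _+_; _∸_; _<_; _≤_; _<ᵇ_; _≡ᵇ_; z≤n; s≤s; s≤s⁻¹; z<s)
open import Data.Nat.ListAction using (sum)
open import Data.Nat.ListAction.Properties using (sum-++)
open import Data.Nat.Properties
  using (_<?_; _≤?_; ≮⇒≥; <⇒≱; ≤∧≢⇒<; +-assoc; +-comm; +-suc; +-identityʳ;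
         +-cancelˡ-≡; +-cancelʳ-≡; +-cancelˡ-≤; m+n≡0⇒m≡0; ≤-refl; ≤-reflexive;
         ≤-trans; <-≤-trans; ≤-<-trans; <⇒≤; <-irrefl; m≤m+n; m<m+n; m≤n⇒m≤1+n;
         m≤n⇒m<n∨m≡n; m∸[m∸n]≡n; m+n∸m≡n; ∸-monoʳ-<; suc-injective; +-0-commutativeMonoid)
open import Data.Nat.Tactic.RingSolver using (solve-∀)
open import Data.Product using (Σ; ∃; ∃₂; _×_; _,_; proj₁; proj₂; map₁; uncurry)
open import Data.Sum using (_⊎_; inj₁; inj₂)
open import Data.Vec as Vec using (Vec; []; _∷_; lookup; tabulate; toList)
open import Data.Vec.Properties
  using (lookup-allFin; lookup∘tabulate; tabulate∘lookup; tabulate-∘; tabulate-cong; map-∷ʳ;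
         length-toList; toList-∷ʳ; toList-injective; cast-is-id)
  renaming (∷ʳ-injective to Vec∷ʳ-injective)
open import Function using (_∘_)
open import Function.Bundles using (_⇔_; mk⇔)
open import Relation.Nullary using (does; yes; no; ¬_; contradiction)
open import Relation.Unary using (Decidable)
open import Relation.Binary.PropositionalEquality

-- Counting letters and inversions

<ᵇ-true : ∀ {j v} → j < v → (j <ᵇ v) ≡ true
<ᵇ-true {zero}  (s≤s _)   = refl
<ᵇ-true {suc j} (s≤s j<v) = <ᵇ-true j<v

<ᵇ-false : ∀ {j v} → v ≤ j → (j <ᵇ v) ≡ false
<ᵇ-false z≤n       = refl
<ᵇ-false (s≤s v≤j) = <ᵇ-false v≤j

≡ᵇ-refl : ∀ n → (n ≡ᵇ n) ≡ true
≡ᵇ-refl zero    = refl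
≡ᵇ-refl (suc n) = ≡ᵇ-refl n

≡ᵇ-true⇒≡ : ∀ {m n} → (m ≡ᵇ n) ≡ true → m ≡ n
≡ᵇ-true⇒≡ {zero}  {zero}  _ = refl
≡ᵇ-true⇒≡ {suc m} {suc n} e = cong suc (≡ᵇ-true⇒≡ e)

≡ᵇ-false : ∀ {m n} → m < n → (m ≡ᵇ n) ≡ false
≡ᵇ-false {zero}  (s≤s _)   = refl
≡ᵇ-false {suc m} (s≤s m<n) = ≡ᵇ-false m<n

iverson : Bool → ℕ
iverson true  = 1
iverson false = 0

count : (ℕ → Bool) → List ℕ → ℕ
count p []       = 0
count p (x ∷ xs) = iverson (p x) + count p xs

count-++ : ∀ p xs ys → count p (xs ++ ys) ≡ count p xs + count p ys
count-++ p []       ys = refl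
count-++ p (x ∷ xs) ys =
  trans (cong (iverson (p x) +_) (count-++ p xs ys)) (sym (+-assoc (iverson (p x)) _ _))

count-map : ∀ p f xs → count p (map f xs) ≡ count (λ v → p (f v)) xs
count-map p f []       = refl
count-map p f (x ∷ xs) = cong (iverson (p (f x)) +_) (count-map p f xs)

length-filter≡count : ∀ {P : ℕ → Set} (P? : Decidable P) xs →
                      length (filter P? xs) ≡ count (λ v → does (P? v)) xs
length-filter≡count P? []       = refl
length-filter≡count P? (x ∷ xs) with does (P? x)
... | true  = cong suc (length-filter≡count P? xs)
... | false = length-filter≡count P? xs

module _ {Q : ℕ → Set} (p : ℕ → Bool) where

  count-none : (∀ {v} → Q v → p v ≡ false) → ∀ {xs} → All Q xs → count p xs ≡ 0
  count-none never []         = refl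
  count-none never (qx ∷ qxs) rewrite never qx = count-none never qxs

  count-all : (∀ {v} → Q v → p v ≡ true) → ∀ {xs} → All Q xs → count p xs ≡ length xs
  count-all always []         = refl
  count-all always (qx ∷ qxs) rewrite always qx = cong suc (count-all always qxs)

iverson-<ᵇ-suc : ∀ v x → iverson (v <ᵇ suc x) ≡ iverson (v <ᵇ x) + iverson (v ≡ᵇ x)
iverson-<ᵇ-suc zero          zero    = refl
iverson-<ᵇ-suc zero          (suc x) = refl
iverson-<ᵇ-suc (suc zero)    zero    = refl
iverson-<ᵇ-suc (suc (suc v)) zero    = refl
iverson-<ᵇ-suc (suc v)       (suc x) = iverson-<ᵇ-suc v x

iverson-trichotomy : ∀ v x → iverson (v <ᵇ x) + iverson (v ≡ᵇ x) + iverson (x <ᵇ v) ≡ 1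
iverson-trichotomy zero    zero    = refl
iverson-trichotomy zero    (suc x) = refl
iverson-trichotomy (suc v) zero    = refl
iverson-trichotomy (suc v) (suc x) = iverson-trichotomy v x

count-<ᵇ-suc : ∀ x xs → count (_<ᵇ suc x) xs ≡ count (_<ᵇ x) xs + count (_≡ᵇ x) xs
count-<ᵇ-suc x []       = refl
count-<ᵇ-suc x (v ∷ xs) =
  trans (cong₂ _+_ (iverson-<ᵇ-suc v x) (count-<ᵇ-suc x xs))
        (shuffle (iverson (v <ᵇ x)) (iverson (v ≡ᵇ x)) (count (_<ᵇ x) xs) (count (_≡ᵇ x) xs))
  where
  shuffle : ∀ a b c d → a + b + (c + d) ≡ a + c + (b + d)
  shuffle = solve-∀

count-trichotomy : ∀ x xs → count (_<ᵇ x) xs + count (_≡ᵇ x) xs + count (x <ᵇ_) xs ≡ length xs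
count-trichotomy x []       = refl
count-trichotomy x (v ∷ xs) =
  trans (shuffle (iverson (v <ᵇ x)) (iverson (v ≡ᵇ x)) (iverson (x <ᵇ v)) _ _ _)
        (cong₂ _+_ (iverson-trichotomy v x) (count-trichotomy x xs))
  where
  shuffle : ∀ a b c d e f → a + d + (b + e) + (c + f) ≡ a + b + c + (d + e + f)
  shuffle = solve-∀

count-≡ᵇ-zero : ∀ {m} xs → All (_≤ m) xs → count (_≡ᵇ m) xs ≡ 0 → All (_< m) xs
count-≡ᵇ-zero []           []           _    = []
count-≡ᵇ-zero {m} (v ∷ xs) (v≤m ∷ xs≤m) none with v ≡ᵇ m in v≟m
... | false = ≤∧≢⇒< v≤m (λ { refl → contradiction (trans (sym (≡ᵇ-refl v)) v≟m) λ () }) ∷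
              count-≡ᵇ-zero xs xs≤m none

inv-cons : ∀ x xs → inv (x ∷ xs) ≡ count (_<ᵇ x) xs + inv xs
inv-cons x xs = cong (_+ inv xs) (length-filter≡count (_<? x) xs)

inv-insert : ∀ A x B → inv (A ++ x ∷ B) ≡ inv (A ++ B) + count (x <ᵇ_) A + count (_<ᵇ x) B
inv-insert []      x B = trans (inv-cons x B) (swap (count (_<ᵇ x) B) (inv B))
  where
  swap : ∀ c i → c + i ≡ i + 0 + c
  swap = solve-∀
inv-insert (a ∷ A) x B = begin
    inv (a ∷ A ++ x ∷ B)
  ≡⟨ inv-cons a (A ++ x ∷ B) ⟩
    count (_<ᵇ a) (A ++ x ∷ B) + inv (A ++ x ∷ B)
  ≡⟨ cong₂ _+_ (count-++ (_<ᵇ a) A (x ∷ B)) (inv-insert A x B) ⟩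
    count (_<ᵇ a) A + (iverson (x <ᵇ a) + count (_<ᵇ a) B) + (inv (A ++ B) + count (x <ᵇ_) A + X)
  ≡⟨ shuffle (count (_<ᵇ a) A) (iverson (x <ᵇ a)) (count (_<ᵇ a) B) (inv (A ++ B)) _ _ ⟩
    (count (_<ᵇ a) A + count (_<ᵇ a) B) + inv (A ++ B) + (iverson (x <ᵇ a) + count (x <ᵇ_) A) + X
  ≡⟨ cong (λ n → n + inv (A ++ B) + (iverson (x <ᵇ a) + count (x <ᵇ_) A) + X) (sym (count-++ (_<ᵇ a) A B)) ⟩
    count (_<ᵇ a) (A ++ B) + inv (A ++ B) + (iverson (x <ᵇ a) + count (x <ᵇ_) A) + X
  ≡⟨ cong (λ n → n + (iverson (x <ᵇ a) + count (x <ᵇ_) A) + X) (sym (inv-cons a (A ++ B))) ⟩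
    inv (a ∷ A ++ B) + (iverson (x <ᵇ a) + count (x <ᵇ_) A) + X
  ∎
  where
  open ≡-Reasoning
  X = count (_<ᵇ x) B
  shuffle : ∀ a b c d e f → a + (b + c) + (d + e + f) ≡ a + c + d + (b + e) + f
  shuffle = solve-∀

inv-insert-max : ∀ {m} A B → All (_< m) A → All (_< m) B → inv (A ++ m ∷ B) ≡ inv (A ++ B) + length B
inv-insert-max {m} A B A<m B<m = begin
    inv (A ++ m ∷ B)
  ≡⟨ inv-insert A m B ⟩
    inv (A ++ B) + count (m <ᵇ_) A + count (_<ᵇ m) B
  ≡⟨ cong₂ (λ a b → inv (A ++ B) + a + b)
       (count-none (m <ᵇ_) (λ v<m → <ᵇ-false (<⇒≤ v<m)) A<m) (count-all (_<ᵇ m) <ᵇ-true B<m) ⟩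
    inv (A ++ B) + 0 + length B
  ≡⟨ cong (_+ length B) (+-identityʳ _) ⟩
    inv (A ++ B) + length B
  ∎
  where open ≡-Reasoning

inv-map-suc : ∀ xs → inv (map suc xs) ≡ inv xs
inv-map-suc []       = refl
inv-map-suc (x ∷ xs) = begin
    inv (suc x ∷ map suc xs)
  ≡⟨ inv-cons (suc x) (map suc xs) ⟩
    count (_<ᵇ suc x) (map suc xs) + inv (map suc xs)
  ≡⟨ cong₂ _+_ (count-map (_<ᵇ suc x) suc xs) (inv-map-suc xs) ⟩
    count (_<ᵇ x) xs + inv xs
  ≡⟨ sym (inv-cons x xs) ⟩
    inv (x ∷ xs)
  ∎
  where open ≡-Reasoning

-- A word lists 0, …, n − 1 in some order (n its length) exactly when, for
-- every z ≤ n, exactly z of its letters are below z.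
IsPermWord : List ℕ → Set
IsPermWord w = ∀ z → z ≤ length w → count (_<ᵇ z) w ≡ z

permWord-count-≡ᵇ : ∀ {w} → IsPermWord w → ∀ {z} → z < length w → count (_≡ᵇ z) w ≡ 1
permWord-count-≡ᵇ {w} perm {z} z<n = +-cancelˡ-≡ z _ _ (begin
    z + count (_≡ᵇ z) w
  ≡⟨ cong (_+ count (_≡ᵇ z) w) (sym (perm z (<⇒≤ z<n))) ⟩
    count (_<ᵇ z) w + count (_≡ᵇ z) w
  ≡⟨ sym (count-<ᵇ-suc z w) ⟩
    count (_<ᵇ suc z) w
  ≡⟨ perm (suc z) z<n ⟩
    suc z
  ≡⟨ +-comm 1 z ⟩
    z + 1
  ∎)
  where open ≡-Reasoning

length-∷ʳ : ∀ {A : Set} (xs : List A) x → length (xs ∷ʳ x) ≡ suc (length xs)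
length-∷ʳ xs x = trans (length-++ xs) (+-comm (length xs) 1)

permWord-last : ∀ A x → IsPermWord (A ∷ʳ x) → x ≤ length A → count (_≡ᵇ x) A ≡ 0
permWord-last A x perm x≤n = +-cancelʳ-≡ 1 _ 0 (begin
    count (_≡ᵇ x) A + 1
  ≡⟨ cong (λ b → count (_≡ᵇ x) A + (iverson b + 0)) (sym (≡ᵇ-refl x)) ⟩
    count (_≡ᵇ x) A + count (_≡ᵇ x) (x ∷ [])
  ≡⟨ sym (count-++ (_≡ᵇ x) A (x ∷ [])) ⟩
    count (_≡ᵇ x) (A ∷ʳ x)
  ≡⟨ permWord-count-≡ᵇ {A ∷ʳ x} perm {x} (subst (x <_) (sym (length-∷ʳ A x)) (s≤s x≤n)) ⟩
    1
  ∎)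
  where open ≡-Reasoning

-- Both sides count the letters below x missing from P, as P has x letters and
-- does not contain x.
permWord-balance : ∀ P L x → IsPermWord (P ++ L ++ x ∷ []) → length P ≡ x →
                   count (x <ᵇ_) P ≡ count (_<ᵇ x) L
permWord-balance P L x perm refl = +-cancelˡ-≡ (count (_<ᵇ x) P) _ _ (begin
    count (_<ᵇ x) P + count (x <ᵇ_) P
  ≡⟨ cong (_+ count (x <ᵇ_) P) (sym (+-identityʳ _)) ⟩
    count (_<ᵇ x) P + 0 + count (x <ᵇ_) P
  ≡⟨ cong (λ e → count (_<ᵇ x) P + e + count (x <ᵇ_) P) (sym no-x-in-P) ⟩
    count (_<ᵇ x) P + count (_≡ᵇ x) P + count (x <ᵇ_) P
  ≡⟨ count-trichotomy x P ⟩
    x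
  ≡⟨ sym (perm x (subst (x ≤_) (sym (length-++ P)) (m≤m+n x _))) ⟩
    count (_<ᵇ x) (P ++ L ++ x ∷ [])
  ≡⟨ trans (count-++ (_<ᵇ x) P (L ++ x ∷ []))
           (cong (count (_<ᵇ x) P +_) (count-++ (_<ᵇ x) L (x ∷ []))) ⟩
    count (_<ᵇ x) P + (count (_<ᵇ x) L + (iverson (x <ᵇ x) + 0))
  ≡⟨ cong (λ b → count (_<ᵇ x) P + (count (_<ᵇ x) L + (iverson b + 0))) (<ᵇ-false {x} ≤-refl) ⟩
    count (_<ᵇ x) P + (count (_<ᵇ x) L + 0)
  ≡⟨ cong (count (_<ᵇ x) P +_) (+-identityʳ _) ⟩
    count (_<ᵇ x) P + count (_<ᵇ x) L
  ∎)
  where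
  open ≡-Reasoning
  no-x-in-P : count (_≡ᵇ x) P ≡ 0
  no-x-in-P = m+n≡0⇒m≡0 _ (trans (sym (count-++ (_≡ᵇ x) P L))
                (permWord-last (P ++ L) x (subst IsPermWord (sym (++-assoc P L (x ∷ []))) perm)
                               (subst (x ≤_) (sym (length-++ P)) (m≤m+n x _))))

permWord-swap : ∀ P a Q x → IsPermWord (P ++ a ∷ Q ++ x ∷ []) → IsPermWord (P ++ x ∷ Q ++ a ∷ [])
permWord-swap P a Q x perm z z≤len =
  trans (same-count (_<ᵇ z)) (perm z (subst (z ≤_) same-length z≤len))
  where
  same-count : ∀ p → count p (P ++ x ∷ Q ++ a ∷ []) ≡ count p (P ++ a ∷ Q ++ x ∷ [])
  same-count p = begin
      count p (P ++ x ∷ Q ++ a ∷ [])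
    ≡⟨ count-++ p P (x ∷ Q ++ a ∷ []) ⟩
      count p P + (iverson (p x) + count p (Q ++ a ∷ []))
    ≡⟨ cong (λ n → count p P + (iverson (p x) + n)) (count-++ p Q (a ∷ [])) ⟩
      count p P + (iverson (p x) + (count p Q + (iverson (p a) + 0)))
    ≡⟨ shuffle (count p P) (iverson (p x)) (count p Q) (iverson (p a)) ⟩
      count p P + (iverson (p a) + (count p Q + (iverson (p x) + 0)))
    ≡⟨ cong (λ n → count p P + (iverson (p a) + n)) (sym (count-++ p Q (x ∷ []))) ⟩
      count p P + (iverson (p a) + count p (Q ++ x ∷ []))
    ≡⟨ sym (count-++ p P (a ∷ Q ++ x ∷ [])) ⟩
      count p (P ++ a ∷ Q ++ x ∷ [])
    ∎
    where
    open ≡-Reasoning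
    shuffle : ∀ n b c d → n + (b + (c + (d + 0))) ≡ n + (d + (c + (b + 0)))
    shuffle = solve-∀
  same-length : length (P ++ x ∷ Q ++ a ∷ []) ≡ length (P ++ a ∷ Q ++ x ∷ [])
  same-length = trans (length-++ P)
    (trans (cong (λ n → length P + suc n) (trans (length-++ Q) (sym (length-++ Q)))) (sym (length-++ P)))

-- Excedances of words

-- Positions and letters are 0-based.  A word is read from position j on, and
-- position i is an excedance of the letter v placed there when i < v.
excPairs : ℕ → List ℕ → List (ℕ × ℕ)
excPairs j []      = []
excPairs j (v ∷ w) = if j <ᵇ v then (j , v) ∷ excPairs (suc j) w else excPairs (suc j) w

nexcPairs : ℕ → List ℕ → List (ℕ × ℕ)
nexcPairs j []      = []
nexcPairs j (v ∷ w) = if j <ᵇ v then nexcPairs (suc j) w else (j , v) ∷ nexcPairs (suc j) w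

excPositions excLetters nexcPositions nexcLetters : ℕ → List ℕ → List ℕ
excPositions  j w = map proj₁ (excPairs j w)
excLetters    j w = map proj₂ (excPairs j w)
nexcPositions j w = map proj₁ (nexcPairs j w)
nexcLetters   j w = map proj₂ (nexcPairs j w)

module _ {j v : ℕ} (w : List ℕ) where

  excPairs-exc : j < v → excPairs j (v ∷ w) ≡ (j , v) ∷ excPairs (suc j) w
  excPairs-exc j<v rewrite <ᵇ-true j<v = refl

  excPairs-nexc : v ≤ j → excPairs j (v ∷ w) ≡ excPairs (suc j) w
  excPairs-nexc v≤j rewrite <ᵇ-false v≤j = refl

  nexcPairs-exc : j < v → nexcPairs j (v ∷ w) ≡ nexcPairs (suc j) w
  nexcPairs-exc j<v rewrite <ᵇ-true j<v = refl

  nexcPairs-nexc : v ≤ j → nexcPairs j (v ∷ w) ≡ (j , v) ∷ nexcPairs (suc j) w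
  nexcPairs-nexc v≤j rewrite <ᵇ-false v≤j = refl

excPairs-++ : ∀ j A B → excPairs j (A ++ B) ≡ excPairs j A ++ excPairs (j + length A) B
excPairs-++ j []      B = cong (λ k → excPairs k B) (sym (+-identityʳ j))
excPairs-++ j (a ∷ A) B with j <ᵇ a | cong (λ k → excPairs k B) (sym (+-suc j (length A)))
... | true  | shift = cong ((j , a) ∷_) (trans (excPairs-++ (suc j) A B) (cong (excPairs (suc j) A ++_) shift))
... | false | shift = trans (excPairs-++ (suc j) A B) (cong (excPairs (suc j) A ++_) shift)

nexcPairs-++ : ∀ j A B → nexcPairs j (A ++ B) ≡ nexcPairs j A ++ nexcPairs (j + length A) B
nexcPairs-++ j []      B = cong (λ k → nexcPairs k B) (sym (+-identityʳ j))
nexcPairs-++ j (a ∷ A) B with j <ᵇ a | cong (λ k → nexcPairs k B) (sym (+-suc j (length A)))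
... | true  | shift = trans (nexcPairs-++ (suc j) A B) (cong (nexcPairs (suc j) A ++_) shift)
... | false | shift = cong ((j , a) ∷_) (trans (nexcPairs-++ (suc j) A B) (cong (nexcPairs (suc j) A ++_) shift))

length-exc+nexc : ∀ j w → length (excPairs j w) + length (nexcPairs j w) ≡ length w
length-exc+nexc j []      = refl
length-exc+nexc j (v ∷ w) with j <ᵇ v
... | true  = cong suc (length-exc+nexc (suc j) w)
... | false = trans (+-suc (length (excPairs (suc j) w)) _) (cong suc (length-exc+nexc (suc j) w))

count-exc+nexc : ∀ p j w → count p w ≡ count p (excLetters j w) + count p (nexcLetters j w)
count-exc+nexc p j []      = refl
count-exc+nexc p j (v ∷ w) with j <ᵇ v
... | true  = trans (cong (iverson (p v) +_) (count-exc+nexc p (suc j) w)) (sym (+-assoc (iverson (p v)) _ _))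
... | false = trans (cong (iverson (p v) +_) (count-exc+nexc p (suc j) w))
                    (shuffle (iverson (p v)) (count p (excLetters (suc j) w)) (count p (nexcLetters (suc j) w)))
  where
  shuffle : ∀ a b c → a + (b + c) ≡ b + (a + c)
  shuffle = solve-∀

module _ {P : ℕ → Set} where

  All-excLetters : ∀ j {w} → All P w → All P (excLetters j w)
  All-excLetters j {[]}    []         = []
  All-excLetters j {v ∷ w} (pv ∷ pw) with j <ᵇ v
  ... | true  = pv ∷ All-excLetters (suc j) pw
  ... | false = All-excLetters (suc j) pw

  All-nexcLetters : ∀ j {w} → All P w → All P (nexcLetters j w)
  All-nexcLetters j {[]}    []         = []
  All-nexcLetters j {v ∷ w} (pv ∷ pw) with j <ᵇ v
  ... | true  = All-nexcLetters (suc j) pw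
  ... | false = pv ∷ All-nexcLetters (suc j) pw

excLetters-> : ∀ j w → All (j <_) (excLetters j w)
excLetters-> j []      = []
excLetters-> j (v ∷ w) with j <? v
... | yes j<v rewrite <ᵇ-true j<v        = j<v ∷ All.map <⇒≤ (excLetters-> (suc j) w)
... | no  j≮v rewrite <ᵇ-false (≮⇒≥ j≮v) = All.map <⇒≤ (excLetters-> (suc j) w)

nexcLetters-< : ∀ j w → All (_< j + length w) (nexcLetters j w)
nexcLetters-< j []      = []
nexcLetters-< j (v ∷ w) with j <? v | subst (λ n → All (_< n) (nexcLetters (suc j) w)) (sym (+-suc j (length w)))
                                         (nexcLetters-< (suc j) w)
... | yes j<v | rest rewrite <ᵇ-true j<v        = rest
... | no  j≮v | rest rewrite <ᵇ-false (≮⇒≥ j≮v) = ≤-<-trans (≮⇒≥ j≮v) (m<m+n j z<s) ∷ rest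

excLetters-++ : ∀ j A B → excLetters j (A ++ B) ≡ excLetters j A ++ excLetters (j + length A) B
excLetters-++ j A B = trans (cong (map proj₂) (excPairs-++ j A B)) (map-++ proj₂ (excPairs j A) _)

nexcLetters-++ : ∀ j A B → nexcLetters j (A ++ B) ≡ nexcLetters j A ++ nexcLetters (j + length A) B
nexcLetters-++ j A B = trans (cong (map proj₂) (nexcPairs-++ j A B)) (map-++ proj₂ (nexcPairs j A) _)

invᵂ : List ℕ → ℕ
invᵂ w = inv (excLetters 0 w) + inv (nexcLetters 0 w)

-- The 1-based positions of den are the 0-based ones plus one.
denᵂ : List ℕ → ℕ
denᵂ w = sum (map suc (excPositions 0 w)) + invᵂ w

sum-map-suc-++ : ∀ A B → sum (map suc (A ++ B)) ≡ sum (map suc A) + sum (map suc B)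
sum-map-suc-++ A B = trans (cong sum (map-++ suc A B)) (sum-++ (map suc A) _)

sum-map-suc-insert : ∀ A p B → sum (map suc (A ++ p ∷ B)) ≡ sum (map suc (A ++ B)) + suc p
sum-map-suc-insert A p B = begin
  sum (map suc (A ++ p ∷ B))                       ≡⟨ sum-map-suc-++ A (p ∷ B) ⟩
  sum (map suc A) + (suc p + sum (map suc B))      ≡⟨ shuffle (sum (map suc A)) p (sum (map suc B)) ⟩
  sum (map suc A) + sum (map suc B) + suc p        ≡⟨ cong (_+ suc p) (sym (sum-map-suc-++ A B)) ⟩
  sum (map suc (A ++ B)) + suc p                   ∎
  where
  open ≡-Reasoning
  shuffle : ∀ a p b → a + (suc p + b) ≡ a + b + suc p
  shuffle = solve-∀

-- The inversions counted by den when the word P is followed by excedance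
-- letters E and non-excedance letters N.
invAfter : List ℕ → List ℕ → List ℕ → ℕ
invAfter P E N = inv (excLetters 0 P ++ E) + inv (nexcLetters 0 P ++ N)

invᵂ-++ : ∀ P T → invᵂ (P ++ T) ≡ invAfter P (excLetters (length P) T) (nexcLetters (length P) T)
invᵂ-++ P T = cong₂ (λ E N → inv E + inv N) (excLetters-++ 0 P T) (nexcLetters-++ 0 P T)

module _ (P : List ℕ) {v : ℕ} where

  excLetters-∷ʳ-exc : length P < v → excLetters 0 (P ∷ʳ v) ≡ excLetters 0 P ∷ʳ v
  excLetters-∷ʳ-exc p<v =
    trans (excLetters-++ 0 P (v ∷ [])) (cong (λ L → excLetters 0 P ++ map proj₂ L) (excPairs-exc [] p<v))

  nexcLetters-∷ʳ-exc : length P < v → nexcLetters 0 (P ∷ʳ v) ≡ nexcLetters 0 P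
  nexcLetters-∷ʳ-exc p<v = trans (nexcLetters-++ 0 P (v ∷ []))
    (trans (cong (λ L → nexcLetters 0 P ++ map proj₂ L) (nexcPairs-exc [] p<v)) (++-identityʳ _))

  excPairs-∷ʳ-nexc : v ≤ length P → excPairs 0 (P ∷ʳ v) ≡ excPairs 0 P
  excPairs-∷ʳ-nexc v≤p =
    trans (excPairs-++ 0 P (v ∷ [])) (trans (cong (excPairs 0 P ++_) (excPairs-nexc [] v≤p)) (++-identityʳ _))

  nexcLetters-∷ʳ-nexc : v ≤ length P → nexcLetters 0 (P ∷ʳ v) ≡ nexcLetters 0 P ∷ʳ v
  nexcLetters-∷ʳ-nexc v≤p =
    trans (nexcLetters-++ 0 P (v ∷ [])) (cong (λ L → nexcLetters 0 P ++ map proj₂ L) (nexcPairs-nexc [] v≤p))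

invAfter-∷ʳ-exc : ∀ P {v} E N → length P < v → invAfter (P ∷ʳ v) E N ≡ invAfter P (v ∷ E) N
invAfter-∷ʳ-exc P {v} E N p<v = cong₂ (λ E′ N′ → inv E′ + inv N′)
  (trans (cong (_++ E) (excLetters-∷ʳ-exc P p<v)) (∷ʳ-++ (excLetters 0 P) v E))
  (cong (_++ N) (nexcLetters-∷ʳ-exc P p<v))

invAfter-∷ʳ-nexc : ∀ P {v} E N → v ≤ length P → invAfter (P ∷ʳ v) E N ≡ invAfter P E (v ∷ N)
invAfter-∷ʳ-nexc P {v} E N v≤p = cong₂ (λ E′ N′ → inv E′ + inv N′)
  (cong (λ L → map proj₂ L ++ E) (excPairs-∷ʳ-nexc P v≤p))
  (trans (cong (_++ N) (nexcLetters-∷ʳ-nexc P v≤p)) (∷ʳ-++ (nexcLetters 0 P) v N))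

module _ (pre : List ℕ) {v : ℕ} (post : List ℕ) where

  excPairs-at-exc : length pre < v →
    excPairs 0 (pre ++ v ∷ post) ≡ excPairs 0 pre ++ (length pre , v) ∷ excPairs (suc (length pre)) post
  excPairs-at-exc p<v = trans (excPairs-++ 0 pre (v ∷ post)) (cong (excPairs 0 pre ++_) (excPairs-exc post p<v))

  excPairs-at-nexc : v ≤ length pre →
    excPairs 0 (pre ++ v ∷ post) ≡ excPairs 0 pre ++ excPairs (suc (length pre)) post
  excPairs-at-nexc v≤p = trans (excPairs-++ 0 pre (v ∷ post)) (cong (excPairs 0 pre ++_) (excPairs-nexc post v≤p))

  nexcPairs-at-nexc : v ≤ length pre →
    nexcPairs 0 (pre ++ v ∷ post) ≡ nexcPairs 0 pre ++ (length pre , v) ∷ nexcPairs (suc (length pre)) post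
  nexcPairs-at-nexc v≤p = trans (nexcPairs-++ 0 pre (v ∷ post)) (cong (nexcPairs 0 pre ++_) (nexcPairs-nexc post v≤p))

nexcLetters-none-above : ∀ P → count (length P <ᵇ_) (nexcLetters 0 P) ≡ 0
nexcLetters-none-above P = count-none (length P <ᵇ_) (λ v<n → <ᵇ-false (<⇒≤ v<n)) (nexcLetters-< 0 P)

excLetters-none-below : ∀ j w → count (_<ᵇ j) (excLetters j w) ≡ 0
excLetters-none-below j w = count-none (_<ᵇ j) (λ j<v → <ᵇ-false (<⇒≤ j<v)) (excLetters-> j w)

excLetters-balance : ∀ P w → IsPermWord (P ++ w ++ length P ∷ []) →
  count (length P <ᵇ_) (excLetters 0 P) ≡ count (_<ᵇ length P) (nexcLetters (length P) w)
excLetters-balance P w perm = begin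
    count (j <ᵇ_) EP                      ≡⟨ sym (+-identityʳ _) ⟩
    count (j <ᵇ_) EP + 0                  ≡⟨ cong (count (j <ᵇ_) EP +_) (sym (nexcLetters-none-above P)) ⟩
    count (j <ᵇ_) EP + count (j <ᵇ_) NP   ≡⟨ sym (count-exc+nexc (j <ᵇ_) 0 P) ⟩
    count (j <ᵇ_) P                       ≡⟨ permWord-balance P w j perm refl ⟩
    count (_<ᵇ j) w                       ≡⟨ count-exc+nexc (_<ᵇ j) j w ⟩
    count (_<ᵇ j) E + count (_<ᵇ j) N     ≡⟨ cong (_+ count (_<ᵇ j) N) (excLetters-none-below j w) ⟩
    count (_<ᵇ j) N                       ∎
  where
  open ≡-Reasoning
  j = length P
  EP = excLetters 0 P
  NP = nexcLetters 0 P
  E = excLetters j w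
  N = nexcLetters j w

invAfter-balance : ∀ P w → IsPermWord (P ++ w ++ length P ∷ []) →
  invAfter P (excLetters (length P) w) (length P ∷ nexcLetters (length P) w)
    ≡ invAfter P (length P ∷ excLetters (length P) w) (nexcLetters (length P) w)
invAfter-balance P w perm = begin
    inv (EP ++ E) + inv (NP ++ j ∷ N)
  ≡⟨ cong (inv (EP ++ E) +_) (inv-insert NP j N) ⟩
    inv (EP ++ E) + (inv (NP ++ N) + count (j <ᵇ_) NP + count (_<ᵇ j) N)
  ≡⟨ cong₂ (λ a b → inv (EP ++ E) + (inv (NP ++ N) + a + b))
           (nexcLetters-none-above P) (sym (excLetters-balance P w perm)) ⟩
    inv (EP ++ E) + (inv (NP ++ N) + 0 + count (j <ᵇ_) EP)
  ≡⟨ shuffle (inv (EP ++ E)) (inv (NP ++ N)) (count (j <ᵇ_) EP) ⟩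
    inv (EP ++ E) + count (j <ᵇ_) EP + 0 + inv (NP ++ N)
  ≡⟨ cong (λ a → inv (EP ++ E) + count (j <ᵇ_) EP + a + inv (NP ++ N)) (sym (excLetters-none-below j w)) ⟩
    inv (EP ++ E) + count (j <ᵇ_) EP + count (_<ᵇ j) E + inv (NP ++ N)
  ≡⟨ cong (_+ inv (NP ++ N)) (sym (inv-insert EP j E)) ⟩
    inv (EP ++ j ∷ E) + inv (NP ++ N)
  ∎
  where
  open ≡-Reasoning
  j = length P
  EP = excLetters 0 P
  NP = nexcLetters 0 P
  E = excLetters j w
  N = nexcLetters j w
  shuffle : ∀ a b c → a + (b + 0 + c) ≡ a + c + 0 + b
  shuffle = solve-∀

-- The insertion scan

sameSide : ℕ → ℕ → ℕ → Bool
sameSide j x a = if j <ᵇ a then j <ᵇ x else not (j <ᵇ x)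

decision : ℕ → ℕ → ℕ → ℕ → ℕ → Bool
decision m p j x a = if x ≡ᵇ m then j ≡ᵇ p else sameSide j x a

sameSide-sym : ∀ j x a → sameSide j x a ≡ sameSide j a x
sameSide-sym j x a with j <ᵇ a | j <ᵇ x
... | true  | true  = refl
... | true  | false = refl
... | false | true  = refl
... | false | false = refl

scan : ℕ → ℕ → ℕ → ℕ → List ℕ → List ℕ × ℕ
scan m p j x []      = [] , x
scan m p j x (a ∷ w) = if decision m p j x a then map₁ (x ∷_) (scan m p (suc j) a w)
                                             else map₁ (a ∷_) (scan m p (suc j) x w)

scanWord : ℕ → ℕ → ℕ → ℕ → List ℕ → List ℕ
scanWord m p j x w = uncurry _∷ʳ_ (scan m p j x w)

insertMax : ℕ → ℕ → List ℕ → List ℕ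
insertMax m p w = scanWord m p 0 m w

scanWord-before : ∀ {m p} j pre a post → p ≡ j + length pre →
                  scanWord m p j m (pre ++ a ∷ post) ≡ pre ++ m ∷ scanWord m p (suc p) a post
scanWord-before {m} j [] a post refl
  rewrite ≡ᵇ-refl m | +-identityʳ j | ≡ᵇ-refl j = refl
scanWord-before {m} {p} j (v ∷ pre) a post p≡
  rewrite ≡ᵇ-refl m | ≡ᵇ-false (<-≤-trans (m<m+n j (z<s {length pre})) (≤-reflexive (sym p≡))) =
  cong (v ∷_) (scanWord-before (suc j) pre a post (trans p≡ (+-suc j (length pre))))

scanWord-past : ∀ {m p} j w → j + length w ≤ p → scanWord m p j m w ≡ w ∷ʳ m
scanWord-past {m} j []      _ = refl
scanWord-past {m} {p} j (v ∷ w) end≤p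
  rewrite ≡ᵇ-refl m | ≡ᵇ-false (<-≤-trans (m<m+n j (z<s {length w})) end≤p)
  = cong (v ∷_) (scanWord-past (suc j) w (subst (_≤ p) (+-suc j (length w)) end≤p))

decision-carried<m : ∀ {m} p j {x} a → x < m → decision m p j x a ≡ sameSide j x a
decision-carried<m p j a x<m rewrite ≡ᵇ-false x<m = refl

module _ {m p j x a : ℕ} (w : List ℕ) (x<m : x < m) where

  scanWord-exc-exc : j < a → j < x → scanWord m p j x (a ∷ w) ≡ x ∷ scanWord m p (suc j) a w
  scanWord-exc-exc j<a j<x rewrite ≡ᵇ-false x<m | <ᵇ-true j<a | <ᵇ-true j<x = refl

  scanWord-exc-nexc : j < a → x ≤ j → scanWord m p j x (a ∷ w) ≡ a ∷ scanWord m p (suc j) x w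
  scanWord-exc-nexc j<a x≤j rewrite ≡ᵇ-false x<m | <ᵇ-true j<a | <ᵇ-false x≤j = refl

  scanWord-nexc-exc : a ≤ j → j < x → scanWord m p j x (a ∷ w) ≡ a ∷ scanWord m p (suc j) x w
  scanWord-nexc-exc a≤j j<x rewrite ≡ᵇ-false x<m | <ᵇ-false a≤j | <ᵇ-true j<x = refl

  scanWord-nexc-nexc : a ≤ j → x ≤ j → scanWord m p j x (a ∷ w) ≡ x ∷ scanWord m p (suc j) a w
  scanWord-nexc-nexc a≤j x≤j rewrite ≡ᵇ-false x<m | <ᵇ-false a≤j | <ᵇ-false x≤j = refl

scanWord-carried-nexc : ∀ {m p} j x w → x < m → All (_< m) w → x ≤ j →
  excPairs j (scanWord m p j x w) ≡ excPairs j w ×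
  nexcLetters j (scanWord m p j x w) ≡ x ∷ nexcLetters j w
scanWord-carried-nexc j x [] x<m [] x≤j rewrite <ᵇ-false x≤j = refl , refl
scanWord-carried-nexc {m} {p} j x (a ∷ w) x<m (a<m ∷ w<m) x≤j with j <? a
... | yes j<a rewrite scanWord-exc-nexc {p = p} w x<m j<a x≤j | <ᵇ-true j<a =
  let (exc≡ , nexc≡) = scanWord-carried-nexc {m} {p} (suc j) x w x<m w<m (m≤n⇒m≤1+n x≤j)
  in cong ((j , a) ∷_) exc≡ , nexc≡
... | no j≮a
  rewrite scanWord-nexc-nexc {p = p} w x<m (≮⇒≥ j≮a) x≤j | <ᵇ-false (≮⇒≥ j≮a) | <ᵇ-false x≤j =
  let (exc≡ , nexc≡) = scanWord-carried-nexc {m} {p} (suc j) a w a<m w<m (m≤n⇒m≤1+n (≮⇒≥ j≮a))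
  in exc≡ , cong (x ∷_) nexc≡

-- Every letter written is on the same side of its position as the letter it
-- replaces, and the last letter lands at position m, beyond every letter.
scanWord-excPositions : ∀ {m p} j x w → x < m → All (_< m) w → m ≤ j + length w →
  excPositions j (scanWord m p j x w) ≡ excPositions j w
scanWord-excPositions j x [] x<m [] m≤j+0
  rewrite <ᵇ-false (≤-trans (<⇒≤ x<m) (subst (_ ≤_) (+-identityʳ j) m≤j+0)) = refl
scanWord-excPositions {m} {p} j x (a ∷ w) x<m (a<m ∷ w<m) m≤end
  with j <? a | j <? x | subst (m ≤_) (+-suc j (length w)) m≤end
... | yes j<a | yes j<x | m≤end′
  rewrite scanWord-exc-exc {p = p} w x<m j<a j<x | <ᵇ-true j<a | <ᵇ-true j<x =
  cong (j ∷_) (scanWord-excPositions {m} {p} (suc j) a w a<m w<m m≤end′)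
... | yes j<a | no j≮x  | m≤end′
  rewrite scanWord-exc-nexc {p = p} w x<m j<a (≮⇒≥ j≮x) | <ᵇ-true j<a =
  cong (j ∷_) (scanWord-excPositions {m} {p} (suc j) x w x<m w<m m≤end′)
... | no j≮a  | yes j<x | m≤end′
  rewrite scanWord-nexc-exc {p = p} w x<m (≮⇒≥ j≮a) j<x | <ᵇ-false (≮⇒≥ j≮a) =
  scanWord-excPositions {m} {p} (suc j) x w x<m w<m m≤end′
... | no j≮a  | no j≮x  | m≤end′
  rewrite scanWord-nexc-nexc {p = p} w x<m (≮⇒≥ j≮a) (≮⇒≥ j≮x)
        | <ᵇ-false (≮⇒≥ j≮a) | <ᵇ-false (≮⇒≥ j≮x) =
  scanWord-excPositions {m} {p} (suc j) a w a<m w<m m≤end′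

-- The carried letter j stops being an excedance letter at position j.
scanWord-invAfter-stop : ∀ {m p} P w → length P < m → All (_< m) w → IsPermWord (P ++ w ++ length P ∷ []) →
  let j = length P ; T = scanWord m p j j w in
  invAfter P (excLetters j T) (nexcLetters j T) ≡ invAfter P (j ∷ excLetters j w) (nexcLetters j w)
scanWord-invAfter-stop {m} {p} P w j<m w<m perm =
  trans (cong₂ (invAfter P) (cong (map proj₂) (proj₁ carried)) (proj₂ carried)) (invAfter-balance P w perm)
  where carried = scanWord-carried-nexc {m} {p} (length P) (length P) w j<m w<m ≤-refl

scanWord-invAfter : ∀ {m p} P j x w → length P ≡ j → j ≤ x → x < m → All (_< m) w → m ≡ j + length w →
  IsPermWord (P ++ w ++ x ∷ []) →
  invAfter P (excLetters j (scanWord m p j x w)) (nexcLetters j (scanWord m p j x w))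
    ≡ invAfter P (x ∷ excLetters j w) (nexcLetters j w)
scanWord-invAfter P j x [] _ j≤x x<m [] m≡j+0 _ =
  ⊥-elim (<-irrefl refl (<-≤-trans x<m (≤-trans (≤-reflexive (trans m≡j+0 (+-identityʳ j))) j≤x)))
scanWord-invAfter {m} {p} P j x (a ∷ w) refl j≤x x<m (a<m ∷ w<m) m≡end perm with m≤n⇒m<n∨m≡n j≤x
... | inj₂ refl = scanWord-invAfter-stop P (a ∷ w) x<m (a<m ∷ w<m) perm
... | inj₁ j<x with j <? a
...   | yes j<a rewrite scanWord-exc-exc {p = p} w x<m j<a j<x | <ᵇ-true j<a | <ᵇ-true j<x = begin
    invAfter P (x ∷ excLetters (suc j) T) (nexcLetters (suc j) T)
  ≡⟨ sym (invAfter-∷ʳ-exc P _ _ j<x) ⟩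
    invAfter (P ∷ʳ x) (excLetters (suc j) T) (nexcLetters (suc j) T)
  ≡⟨ scanWord-invAfter (P ∷ʳ x) (suc j) a w (length-∷ʳ P x) j<a a<m w<m
       (trans m≡end (+-suc j (length w)))
       (subst IsPermWord (sym (∷ʳ-++ P x (w ++ a ∷ []))) (permWord-swap P a w x perm)) ⟩
    invAfter (P ∷ʳ x) (a ∷ excLetters (suc j) w) (nexcLetters (suc j) w)
  ≡⟨ invAfter-∷ʳ-exc P _ _ j<x ⟩
    invAfter P (x ∷ a ∷ excLetters (suc j) w) (nexcLetters (suc j) w)
  ∎
  where
  open ≡-Reasoning
  T = scanWord m p (suc j) a w
...   | no j≮a rewrite scanWord-nexc-exc {p = p} w x<m (≮⇒≥ j≮a) j<x | <ᵇ-false (≮⇒≥ j≮a) = begin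
    invAfter P (excLetters (suc j) T) (a ∷ nexcLetters (suc j) T)
  ≡⟨ sym (invAfter-∷ʳ-nexc P _ _ (≮⇒≥ j≮a)) ⟩
    invAfter (P ∷ʳ a) (excLetters (suc j) T) (nexcLetters (suc j) T)
  ≡⟨ scanWord-invAfter (P ∷ʳ a) (suc j) x w (length-∷ʳ P a) j<x x<m w<m
       (trans m≡end (+-suc j (length w)))
       (subst IsPermWord (sym (∷ʳ-++ P a (w ++ x ∷ []))) perm) ⟩
    invAfter (P ∷ʳ a) (x ∷ excLetters (suc j) w) (nexcLetters (suc j) w)
  ≡⟨ invAfter-∷ʳ-nexc P _ _ (≮⇒≥ j≮a) ⟩
    invAfter P (x ∷ excLetters (suc j) w) (a ∷ nexcLetters (suc j) w)
  ∎
  where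
  open ≡-Reasoning
  T = scanWord m p (suc j) x w

insertMax-end : ∀ {m} w → length w ≡ m → All (_< m) w →
  excPositions 0 (insertMax m m w) ≡ excPositions 0 w × denᵂ (insertMax m m w) ≡ denᵂ w
insertMax-end w refl w<m =
  subst (λ W → excPositions 0 W ≡ excPositions 0 w × denᵂ W ≡ denᵂ w) (sym (scanWord-past 0 w ≤-refl))
    (cong (map proj₁) exc≡ ,
     cong₂ (λ E n → sum (map suc (map proj₁ E)) + (inv (map proj₂ E) + n)) exc≡ nexc≡)
  where
  open ≡-Reasoning
  N = nexcLetters 0 w
  exc≡ : excPairs 0 (w ∷ʳ length w) ≡ excPairs 0 w
  exc≡ = excPairs-∷ʳ-nexc w ≤-refl
  nexc≡ : inv (nexcLetters 0 (w ∷ʳ length w)) ≡ inv N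
  nexc≡ = begin
    inv (nexcLetters 0 (w ∷ʳ length w))  ≡⟨ cong inv (nexcLetters-∷ʳ-nexc w ≤-refl) ⟩
    inv (N ++ length w ∷ [])             ≡⟨ inv-insert-max N [] (All-nexcLetters 0 w<m) [] ⟩
    inv (N ++ []) + 0                    ≡⟨ trans (+-identityʳ _) (cong inv (++-identityʳ N)) ⟩
    inv N                                ∎

module _ {m : ℕ} (pre : List ℕ) (a : ℕ) (post : List ℕ)
         (ends-at-m : length (pre ++ a ∷ post) ≡ m) (letters<m : All (_< m) (pre ++ a ∷ post)) where

  private
    w = pre ++ a ∷ post
    p = length pre
    T = scanWord m p (suc p) a post
    EP = excLetters 0 pre
    NP = nexcLetters 0 pre
    E = excLetters (suc p) post
    N = nexcLetters (suc p) post
    X = length (excPairs (suc p) post)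

    a<m : a < m
    a<m = All.head (All.++⁻ʳ pre letters<m)
    post<m : All (_< m) post
    post<m = All.tail (All.++⁻ʳ pre letters<m)
    EP<m : All (_< m) EP
    EP<m = All-excLetters 0 (All.++⁻ˡ pre letters<m)
    m≡end : m ≡ suc p + length post
    m≡end = trans (sym ends-at-m) (trans (length-++ pre) (+-suc p (length post)))
    p<m : p < m
    p<m = ≤-trans (s≤s (m≤m+n p (length post))) (≤-reflexive (sym m≡end))
    length-E : length E ≡ X
    length-E = length-map proj₂ (excPairs (suc p) post)

    inserted : insertMax m p w ≡ pre ++ m ∷ T
    inserted = scanWord-before 0 pre a post refl
    excPairs-inserted : excPairs 0 (pre ++ m ∷ T) ≡ excPairs 0 pre ++ (p , m) ∷ excPairs (suc p) T
    excPairs-inserted = excPairs-at-exc pre T p<m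
    excPositions-inserted : excPositions 0 (pre ++ m ∷ T) ≡ excPositions 0 pre ++ p ∷ excPositions (suc p) T
    excPositions-inserted = trans (cong (map proj₁) excPairs-inserted) (map-++ proj₁ (excPairs 0 pre) _)
    invᵂ-inserted : invᵂ (pre ++ m ∷ T) ≡ invAfter pre (m ∷ excLetters (suc p) T) (nexcLetters (suc p) T)
    invᵂ-inserted = trans (invᵂ-++ pre (m ∷ T))
      (cong₂ (invAfter pre) (cong (map proj₂) (excPairs-exc T p<m)) (cong (map proj₂) (nexcPairs-exc T p<m)))

  excPositions-at-exc : p < a → excPositions 0 (pre ++ m ∷ T) ≡ excPositions 0 w
  excPositions-at-exc p<a = begin
      excPositions 0 (pre ++ m ∷ T)
    ≡⟨ excPositions-inserted ⟩
      excPositions 0 pre ++ p ∷ excPositions (suc p) T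
    ≡⟨ cong (λ L → excPositions 0 pre ++ p ∷ L) (scanWord-excPositions (suc p) a post a<m post<m (≤-reflexive m≡end)) ⟩
      excPositions 0 pre ++ p ∷ excPositions (suc p) post
    ≡⟨ sym (map-++ proj₁ (excPairs 0 pre) _) ⟩
      map proj₁ (excPairs 0 pre ++ (p , a) ∷ excPairs (suc p) post)
    ≡⟨ cong (map proj₁) (sym (excPairs-at-exc pre post p<a)) ⟩
      excPositions 0 w
    ∎
    where open ≡-Reasoning

  invᵂ-at-exc : IsPermWord (w ∷ʳ m) → p < a → invᵂ (pre ++ m ∷ T) ≡ invᵂ w + suc X
  invᵂ-at-exc perm p<a = begin
      invᵂ (pre ++ m ∷ T)
    ≡⟨ invᵂ-inserted ⟩
      invAfter pre (m ∷ excLetters (suc p) T) (nexcLetters (suc p) T)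
    ≡⟨ sym (invAfter-∷ʳ-exc pre _ _ p<m) ⟩
      invAfter (pre ∷ʳ m) (excLetters (suc p) T) (nexcLetters (suc p) T)
    ≡⟨ scanWord-invAfter (pre ∷ʳ m) (suc p) a post (length-∷ʳ pre m) p<a a<m post<m m≡end perm′ ⟩
      invAfter (pre ∷ʳ m) (a ∷ E) N
    ≡⟨ invAfter-∷ʳ-exc pre _ _ p<m ⟩
      inv (EP ++ m ∷ a ∷ E) + inv (NP ++ N)
    ≡⟨ cong (_+ inv (NP ++ N)) (inv-insert-max EP (a ∷ E) EP<m (a<m ∷ All-excLetters (suc p) post<m)) ⟩
      inv (EP ++ a ∷ E) + suc (length E) + inv (NP ++ N)
    ≡⟨ shuffle (inv (EP ++ a ∷ E)) (length E) (inv (NP ++ N)) ⟩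
      invAfter pre (a ∷ E) N + suc (length E)
    ≡⟨ cong₂ _+_ (sym (trans (invᵂ-++ pre (a ∷ post)) (cong₂ (invAfter pre)
                    (cong (map proj₂) (excPairs-exc post p<a)) (cong (map proj₂) (nexcPairs-exc post p<a)))))
                 (cong suc length-E) ⟩
      invᵂ w + suc X
    ∎
    where
    open ≡-Reasoning
    perm′ : IsPermWord ((pre ∷ʳ m) ++ post ++ a ∷ [])
    perm′ = subst IsPermWord (sym (∷ʳ-++ pre m (post ++ a ∷ [])))
              (permWord-swap pre a post m (subst IsPermWord (++-assoc pre (a ∷ post) (m ∷ [])) perm))
    shuffle : ∀ i e n → i + suc e + n ≡ i + n + suc e
    shuffle = solve-∀

  insertMax-at-exc : IsPermWord (w ∷ʳ m) → p < a →
    excPositions 0 (insertMax m p w) ≡ excPositions 0 w × denᵂ (insertMax m p w) ≡ denᵂ w + suc X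
  insertMax-at-exc perm p<a rewrite inserted =
    excPositions-at-exc p<a ,
    trans (cong₂ (λ P I → sum (map suc P) + I) (excPositions-at-exc p<a) (invᵂ-at-exc perm p<a))
          (sym (+-assoc (sum (map suc (excPositions 0 w))) _ _))

  private
    carried = scanWord-carried-nexc {m} {p} (suc p) a post a<m post<m

  invᵂ-at-nexc : a ≤ p → invᵂ (pre ++ m ∷ T) ≡ invᵂ w + X
  invᵂ-at-nexc a≤p = begin
      invᵂ (pre ++ m ∷ T)
    ≡⟨ invᵂ-inserted ⟩
      invAfter pre (m ∷ excLetters (suc p) T) (nexcLetters (suc p) T)
    ≡⟨ cong₂ (λ E′ N′ → invAfter pre (m ∷ E′) N′) (cong (map proj₂) (proj₁ (carried (m≤n⇒m≤1+n a≤p))))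
                                                  (proj₂ (carried (m≤n⇒m≤1+n a≤p))) ⟩
      inv (EP ++ m ∷ E) + inv (NP ++ a ∷ N)
    ≡⟨ cong (_+ inv (NP ++ a ∷ N)) (inv-insert-max EP E EP<m (All-excLetters (suc p) post<m)) ⟩
      inv (EP ++ E) + length E + inv (NP ++ a ∷ N)
    ≡⟨ shuffle (inv (EP ++ E)) (length E) (inv (NP ++ a ∷ N)) ⟩
      invAfter pre E (a ∷ N) + length E
    ≡⟨ cong₂ _+_ (sym (trans (invᵂ-++ pre (a ∷ post)) (cong₂ (invAfter pre)
                    (cong (map proj₂) (excPairs-nexc post a≤p)) (cong (map proj₂) (nexcPairs-nexc post a≤p)))))
                 length-E ⟩
      invᵂ w + X
    ∎
    where
    open ≡-Reasoning
    shuffle : ∀ i e n → i + e + n ≡ i + n + e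
    shuffle = solve-∀

  insertMax-at-nexc : a ≤ p →
    excPositions 0 (insertMax m p w) ≡ excPositions 0 pre ++ p ∷ excPositions (suc p) post ×
    excPositions 0 w ≡ excPositions 0 pre ++ excPositions (suc p) post ×
    denᵂ (insertMax m p w) ≡ denᵂ w + (suc p + X)
  insertMax-at-nexc a≤p rewrite inserted = excW≡ , excw≡ , den≡
    where
    open ≡-Reasoning
    A = excPositions 0 pre
    B = excPositions (suc p) post
    excW≡ : excPositions 0 (pre ++ m ∷ T) ≡ A ++ p ∷ B
    excW≡ = trans excPositions-inserted (cong (λ L → A ++ p ∷ map proj₁ L) (proj₁ (carried (m≤n⇒m≤1+n a≤p))))
    excw≡ : excPositions 0 w ≡ A ++ B
    excw≡ = trans (cong (map proj₁) (excPairs-at-nexc pre post a≤p)) (map-++ proj₁ (excPairs 0 pre) _)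
    den≡ : denᵂ (pre ++ m ∷ T) ≡ denᵂ w + (suc p + X)
    den≡ = begin
        sum (map suc (excPositions 0 (pre ++ m ∷ T))) + invᵂ (pre ++ m ∷ T)
      ≡⟨ cong₂ (λ P I → sum (map suc P) + I) excW≡ (invᵂ-at-nexc a≤p) ⟩
        sum (map suc (A ++ p ∷ B)) + (invᵂ w + X)
      ≡⟨ cong (_+ (invᵂ w + X)) (trans (sum-map-suc-insert A p B) (cong (λ P → sum (map suc P) + suc p) (sym excw≡))) ⟩
        sum (map suc (excPositions 0 w)) + suc p + (invᵂ w + X)
      ≡⟨ shuffle (sum (map suc (excPositions 0 w))) p (invᵂ w) X ⟩
        denᵂ w + (suc p + X)
      ∎
      where
      shuffle : ∀ s p i x → s + suc p + (i + x) ≡ s + i + (suc p + x)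
      shuffle = solve-∀

excCount : List ℕ → ℕ
excCount w = length (excPairs 0 w)

-- The insertion position encoding the increment c of den: the end of the word
-- for c = 0, the c-th excedance counted from the right for 1 ≤ c ≤ excCount w,
-- and otherwise the (c − excCount w)-th non-excedance counted from the left
-- (the default 0 is only reached for c > length w).
position : ℕ → List ℕ → ℕ → ℕ
position m w zero    = m
position m w (suc c) = if c <ᵇ excCount w
  then fromMaybe 0 (nth (excPositions 0 w) (excCount w ∸ suc c))
  else fromMaybe 0 (nth (nexcPositions 0 w) (suc c ∸ excCount w ∸ 1))

module _ {m : ℕ} {w : List ℕ} {c : ℕ} where

  position-exc : c < excCount w →
    position m w (suc c) ≡ fromMaybe 0 (nth (excPositions 0 w) (excCount w ∸ suc c))
  position-exc c<k rewrite <ᵇ-true c<k = refl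

  position-nexc : ¬ c < excCount w →
    position m w (suc c) ≡ fromMaybe 0 (nth (nexcPositions 0 w) (suc c ∸ excCount w ∸ 1))
  position-nexc c≮k rewrite <ᵇ-false (≮⇒≥ c≮k) = refl

excSplit : ∀ j w i → i < length (excPairs j w) →
  ∃ λ pre → ∃₂ λ a post → w ≡ pre ++ a ∷ post × j + length pre < a × length (excPairs j pre) ≡ i
excSplit j (v ∷ w) i i<n with j <? v | i
... | yes j<v | zero = [] , v , w , refl , subst (_< v) (sym (+-identityʳ j)) j<v , refl
... | yes j<v | suc i′
  with excSplit (suc j) w i′ (s≤s⁻¹ (subst (λ L → suc i′ < length L) (excPairs-exc w j<v) i<n))
...   | pre , a , post , refl , j+n<a , n≡i =
  v ∷ pre , a , post , refl , subst (_< a) (sym (+-suc j (length pre))) j+n<a ,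
  trans (cong length (excPairs-exc pre j<v)) (cong suc n≡i)
excSplit j (v ∷ w) _ i<n | no j≮v | i
  with excSplit (suc j) w i (subst (λ L → i < length L) (excPairs-nexc w (≮⇒≥ j≮v)) i<n)
...   | pre , a , post , refl , j+n<a , n≡i =
  v ∷ pre , a , post , refl , subst (_< a) (sym (+-suc j (length pre))) j+n<a ,
  trans (cong length (excPairs-nexc pre (≮⇒≥ j≮v))) n≡i

nexcSplit : ∀ j w i → i < length (nexcPairs j w) →
  ∃ λ pre → ∃₂ λ a post → w ≡ pre ++ a ∷ post × a ≤ j + length pre × length (nexcPairs j pre) ≡ i
nexcSplit j (v ∷ w) i i<n with j <? v | i
... | no j≮v | zero = [] , v , w , refl , subst (v ≤_) (sym (+-identityʳ j)) (≮⇒≥ j≮v) , refl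
... | no j≮v | suc i′
  with nexcSplit (suc j) w i′ (s≤s⁻¹ (subst (λ L → suc i′ < length L) (nexcPairs-nexc w (≮⇒≥ j≮v)) i<n))
...   | pre , a , post , refl , a≤j+n , n≡i =
  v ∷ pre , a , post , refl , subst (a ≤_) (sym (+-suc j (length pre))) a≤j+n ,
  trans (cong length (nexcPairs-nexc pre (≮⇒≥ j≮v))) (cong suc n≡i)
nexcSplit j (v ∷ w) _ i<n | yes j<v | i
  with nexcSplit (suc j) w i (subst (λ L → i < length L) (nexcPairs-exc w j<v) i<n)
...   | pre , a , post , refl , a≤j+n , n≡i =
  v ∷ pre , a , post , refl , subst (a ≤_) (sym (+-suc j (length pre))) a≤j+n ,
  trans (cong length (nexcPairs-exc pre j<v)) n≡i

nth-map-++ : ∀ {A : Set} (f : A → ℕ) xs y ys → nth (map f (xs ++ y ∷ ys)) (length xs) ≡ just (f y)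
nth-map-++ f []       y ys = refl
nth-map-++ f (x ∷ xs) y ys = nth-map-++ f xs y ys

nth-map-suc : ∀ xs i {y} → nth xs i ≡ just y → nth (map suc xs) i ≡ just (suc y)
nth-map-suc (x ∷ xs) zero    refl = refl
nth-map-suc (x ∷ xs) (suc i) eq   = nth-map-suc xs i eq

module _ (pre : List ℕ) {a : ℕ} (post : List ℕ) where

  nth-excPositions : length pre < a →
    nth (excPositions 0 (pre ++ a ∷ post)) (length (excPairs 0 pre)) ≡ just (length pre)
  nth-excPositions p<a =
    trans (cong (λ L → nth (map proj₁ L) _) (excPairs-at-exc pre post p<a))
          (nth-map-++ proj₁ (excPairs 0 pre) _ _)

  nth-nexcPositions : a ≤ length pre →
    nth (nexcPositions 0 (pre ++ a ∷ post)) (length (nexcPairs 0 pre)) ≡ just (length pre)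
  nth-nexcPositions a≤p =
    trans (cong (λ L → nth (map proj₁ L) _) (nexcPairs-at-nexc pre post a≤p))
          (nth-map-++ proj₁ (nexcPairs 0 pre) _ _)

index-sum : ∀ k c → k < c → suc (k + (c ∸ k ∸ 1)) ≡ c
index-sum zero    (suc c) _         = refl
index-sum (suc k) (suc c) (s≤s k<c) = cong suc (index-sum k c k<c)

index-bound : ∀ k c n → k < c → c ≤ k + n → c ∸ k ∸ 1 < n
index-bound k c n k<c c≤k+n =
  +-cancelˡ-≤ k (suc (c ∸ k ∸ 1)) n (subst (_≤ k + n) (trans (sym (index-sum k c k<c)) (sym (+-suc k _))) c≤k+n)

data PositionView (m : ℕ) (w : List ℕ) (c : ℕ) : Set where
  at-end  : c ≡ 0 → position m w c ≡ m → PositionView m w c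
  at-exc  : ∀ pre a post → w ≡ pre ++ a ∷ post → length pre < a → position m w c ≡ length pre →
            c ≤ excCount w → c ≡ suc (length (excPairs (suc (length pre)) post)) → PositionView m w c
  at-nexc : ∀ pre a post → w ≡ pre ++ a ∷ post → a ≤ length pre → position m w c ≡ length pre →
            excCount w < c → nth (nexcPositions 0 w) (c ∸ excCount w ∸ 1) ≡ just (length pre) →
            c ≡ suc (length pre) + length (excPairs (suc (length pre)) post) → PositionView m w c

positionView-exc : ∀ m w c → c < excCount w → PositionView m w (suc c)
positionView-exc m w c c<k with excSplit 0 w (excCount w ∸ suc c) (∸-monoʳ-< z<s c<k)
... | pre , a , post , refl , p<a , e≡ = at-exc pre a post refl p<a position≡ c<k c≡
  where
  open ≡-Reasoning
  k = excCount (pre ++ a ∷ post)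
  E = length (excPairs 0 pre)
  X = length (excPairs (suc (length pre)) post)
  position≡ : position m (pre ++ a ∷ post) (suc c) ≡ length pre
  position≡ = trans (position-exc {m} {pre ++ a ∷ post} c<k) (cong (fromMaybe 0)
    (subst (λ i → nth (excPositions 0 (pre ++ a ∷ post)) i ≡ just (length pre)) e≡ (nth-excPositions pre post p<a)))
  c≡ : suc c ≡ suc X
  c≡ = begin
    suc c            ≡⟨ sym (m∸[m∸n]≡n c<k) ⟩
    k ∸ (k ∸ suc c)  ≡⟨ cong₂ _∸_ (trans (cong length (excPairs-at-exc pre post p<a)) (length-++ (excPairs 0 pre)))
                                  (sym e≡) ⟩
    E + suc X ∸ E    ≡⟨ m+n∸m≡n E _ ⟩
    suc X            ∎

positionView-nexc : ∀ m w c → length w ≡ m → suc c ≤ m → ¬ c < excCount w → PositionView m w (suc c)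
positionView-nexc m w c len c<m c≮k with nexcSplit 0 w (suc c ∸ excCount w ∸ 1) i<n
  where
  i<n : suc c ∸ excCount w ∸ 1 < length (nexcPairs 0 w)
  i<n = index-bound (excCount w) (suc c) _ (s≤s (≮⇒≥ c≮k))
          (subst (suc c ≤_) (sym (trans (length-exc+nexc 0 w) len)) c<m)
... | pre , a , post , refl , a≤p , n≡i =
  at-nexc pre a post refl a≤p position≡ (s≤s (≮⇒≥ c≮k)) nth≡ c≡
  where
  open ≡-Reasoning
  k = excCount (pre ++ a ∷ post)
  i = suc c ∸ k ∸ 1
  E = length (excPairs 0 pre)
  X = length (excPairs (suc (length pre)) post)
  nth≡ : nth (nexcPositions 0 (pre ++ a ∷ post)) i ≡ just (length pre)
  nth≡ = subst (λ i → nth (nexcPositions 0 (pre ++ a ∷ post)) i ≡ just (length pre)) n≡i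
               (nth-nexcPositions pre post a≤p)
  position≡ : position m (pre ++ a ∷ post) (suc c) ≡ length pre
  position≡ = trans (position-nexc {m} {pre ++ a ∷ post} c≮k) (cong (fromMaybe 0) nth≡)
  c≡ : suc c ≡ suc (length pre) + X
  c≡ = begin
    suc c                                   ≡⟨ sym (index-sum k (suc c) (s≤s (≮⇒≥ c≮k))) ⟩
    suc (k + i)                             ≡⟨ cong (λ k′ → suc (k′ + i)) (trans (cong length (excPairs-at-nexc pre post a≤p))
                                                                                  (length-++ (excPairs 0 pre))) ⟩
    suc (E + X + i)                         ≡⟨ shuffle E X i ⟩
    suc (E + i) + X                         ≡⟨ cong (λ n → suc (E + n) + X) (sym n≡i) ⟩
    suc (E + length (nexcPairs 0 pre)) + X  ≡⟨ cong (λ n → suc n + X) (length-exc+nexc 0 pre) ⟩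
    suc (length pre) + X                    ∎
    where
    shuffle : ∀ e x i → suc (e + x + i) ≡ suc (e + i) + x
    shuffle = solve-∀

positionView : ∀ m w c → length w ≡ m → c ≤ m → PositionView m w c
positionView m w zero    _   _   = at-end refl refl
positionView m w (suc c) len c≤m with c <? excCount w
... | yes c<k = positionView-exc m w c c<k
... | no  c≮k = positionView-nexc m w c len c≤m c≮k

pre<length : ∀ (pre : List ℕ) a post → length pre < length (pre ++ a ∷ post)
pre<length pre a post = subst (length pre <_) (sym (length-++ pre)) (m<m+n (length pre) z<s)

insertMax-position : ∀ {m} w c → length w ≡ m → All (_< m) w → IsPermWord (w ∷ʳ m) → c ≤ m →
  let p = position m w c ; W = insertMax m p w in
  p ≤ m ×
  (c ≤ excCount w → excPositions 0 W ≡ excPositions 0 w) ×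
  (excCount w < c → nth (nexcPositions 0 w) (c ∸ excCount w ∸ 1) ≡ just p ×
     ∃₂ λ A B → excPositions 0 W ≡ A ++ p ∷ B × excPositions 0 w ≡ A ++ B) ×
  denᵂ W ≡ denᵂ w + c
insertMax-position {m} w c len w<m perm c≤m with positionView m w c len c≤m
... | at-end refl p≡ rewrite p≡ =
  ≤-refl , (λ _ → proj₁ end) , (λ ()) , trans (proj₂ end) (sym (+-identityʳ _))
  where end = insertMax-end w len w<m
... | at-exc pre a post refl p<a p≡ c≤k c≡ rewrite p≡ =
  <⇒≤ p<m , (λ _ → proj₁ facts) , (λ k<c → ⊥-elim (<-irrefl refl (<-≤-trans k<c c≤k))) ,
  trans (proj₂ facts) (cong (denᵂ (pre ++ a ∷ post) +_) (sym c≡))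
  where
  facts = insertMax-at-exc pre a post len w<m perm p<a
  p<m = ≤-trans (pre<length pre a post) (≤-reflexive len)
... | at-nexc pre a post refl a≤p p≡ k<c nth≡ c≡ rewrite p≡ =
  <⇒≤ p<m , (λ c≤k → ⊥-elim (<-irrefl refl (<-≤-trans k<c c≤k))) ,
  (λ _ → nth≡ , excPositions 0 pre , excPositions (suc (length pre)) post , proj₁ facts , proj₁ (proj₂ facts)) ,
  trans (proj₂ (proj₂ facts)) (cong (denᵂ (pre ++ a ∷ post) +_) (sym c≡))
  where
  facts = insertMax-at-nexc pre a post len w<m a≤p
  p<m = ≤-trans (pre<length pre a post) (≤-reflexive len)

-- Undoing the scan

decisions : ℕ → ℕ → ℕ → ℕ → List ℕ → List Bool
decisions m p j x []      = []
decisions m p j x (a ∷ w) = decision m p j x a ∷ decisions m p (suc j) (if decision m p j x a then a else x) w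

decisions-before-position : ∀ {m p j a} w → j < p →
                            decisions m p j m (a ∷ w) ≡ false ∷ decisions m p (suc j) m w
decisions-before-position {m} w j<p rewrite ≡ᵇ-refl m | ≡ᵇ-false j<p = refl

unrearrange : {A : Set} → List Bool → List A → A → List A × A
unrearrange []           os       y = os , y
unrearrange (b ∷ bs)     []       y = [] , y
unrearrange (true ∷ bs)  (o ∷ os) y = proj₂ (unrearrange bs os y) ∷ proj₁ (unrearrange bs os y) , o
unrearrange (false ∷ bs) (o ∷ os) y = map₁ (o ∷_) (unrearrange bs os y)

unrearrange-scan : ∀ m p j x w →
  unrearrange (decisions m p j x w) (proj₁ (scan m p j x w)) (proj₂ (scan m p j x w)) ≡ (w , x)
unrearrange-scan m p j x []      = refl
unrearrange-scan m p j x (a ∷ w) with decision m p j x a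
... | true  rewrite unrearrange-scan m p (suc j) a w = refl
... | false rewrite unrearrange-scan m p (suc j) x w = refl

-- Reading the scanned word from the right, with o the letter at position j
-- and c the letter carried back to it, o was put there by an exchange exactly
-- when o is the maximum m, or when neither is m and they lie on the same side.
backDecision : ℕ → ℕ → ℕ → ℕ → Bool
backDecision m j o c = if o ≡ᵇ m then true else (if c ≡ᵇ m then false else sameSide j c o)

backDecision-<m : ∀ {m j o c} → o < m → c < m → backDecision m j o c ≡ sameSide j c o
backDecision-<m o<m c<m rewrite ≡ᵇ-false o<m | ≡ᵇ-false c<m = refl

-- The decisions of a scan producing (os , y), and the letter it carried at position j.
backScan : ℕ → ℕ → List ℕ → ℕ → List Bool × ℕ
backScan m j []       y = [] , y
backScan m j (o ∷ os) y =
  backDecision m j o (proj₂ (backScan m (suc j) os y)) ∷ proj₁ (backScan m (suc j) os y) ,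
  (if backDecision m j o (proj₂ (backScan m (suc j) os y)) then o else proj₂ (backScan m (suc j) os y))

module _ {m p j x a : ℕ} (x≤m : x ≤ m) (a<m : a < m) where

  backDecision-exchange : decision m p j x a ≡ true → backDecision m j x a ≡ true
  backDecision-exchange d with m≤n⇒m<n∨m≡n x≤m
  ... | inj₂ refl rewrite ≡ᵇ-refl x = refl
  ... | inj₁ x<m rewrite ≡ᵇ-false x<m | ≡ᵇ-false a<m = trans (sameSide-sym j a x) d

  backDecision-keep : decision m p j x a ≡ false → backDecision m j a x ≡ false
  backDecision-keep d with m≤n⇒m<n∨m≡n x≤m
  ... | inj₂ refl rewrite ≡ᵇ-false a<m | ≡ᵇ-refl x = refl
  ... | inj₁ x<m rewrite ≡ᵇ-false x<m | ≡ᵇ-false a<m = d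

backScan-scan : ∀ m p j x w → All (_< m) w → x ≤ m →
  backScan m j (proj₁ (scan m p j x w)) (proj₂ (scan m p j x w)) ≡ (decisions m p j x w , x)
backScan-scan m p j x []      []          x≤m = refl
backScan-scan m p j x (a ∷ w) (a<m ∷ w<m) x≤m with decision m p j x a in d
... | true  rewrite backScan-scan m p (suc j) a w w<m (<⇒≤ a<m) | backDecision-exchange {p = p} x≤m a<m d = refl
... | false rewrite backScan-scan m p (suc j) x w w<m x≤m | backDecision-keep {p = p} x≤m a<m d = refl

unrearrange-backScan : ∀ m j os y →
  proj₂ (unrearrange (proj₁ (backScan m j os y)) os y) ≡ proj₂ (backScan m j os y)
unrearrange-backScan m j []       y = refl
unrearrange-backScan m j (o ∷ os) y with backDecision m j o (proj₂ (backScan m (suc j) os y))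
... | true  = refl
... | false = unrearrange-backScan m (suc j) os y

decisions-backScan-<m : ∀ m p j os y → All (_< m) os → y < m →
  let (bs , c) = backScan m j os y in
  c < m × decisions m p j c (proj₁ (unrearrange bs os y)) ≡ bs
decisions-backScan-<m m p j []       y []          y<m = y<m , refl
decisions-backScan-<m m p j (o ∷ os) y (o<m ∷ os<m) y<m
  with backScan m (suc j) os y | decisions-backScan-<m m p (suc j) os y os<m y<m | unrearrange-backScan m (suc j) os y
... | bs , c | c<m , ih | carried≡ with backDecision m j o c | backDecision-<m {j = j} o<m c<m
...   | true  | same rewrite carried≡ | decision-carried<m p j c o<m | sameSide-sym j o c | sym same =
  o<m , cong (true ∷_) ih
...   | false | same rewrite decision-carried<m p j o c<m | sym same =
  c<m , cong (false ∷_) ih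

firstSwap : List Bool → ℕ
firstSwap []           = 0
firstSwap (true ∷ bs)  = 0
firstSwap (false ∷ bs) = suc (firstSwap bs)

decisions-backScan : ∀ m j os y → All (_≤ m) os → y ≤ m → count (_≡ᵇ m) (os ∷ʳ y) ≡ 1 →
  let (bs , c) = backScan m j os y in
  c ≡ m × decisions m (j + firstSwap bs) j m (proj₁ (unrearrange bs os y)) ≡ bs
decisions-backScan m j [] y [] y≤m once with y ≡ᵇ m in y≟m
... | true = ≡ᵇ-true⇒≡ y≟m , refl
decisions-backScan m j (o ∷ os) y (o≤m ∷ os≤m) y≤m once with o ≡ᵇ m in o≟m
... | true with backScan m (suc j) os y | decisions-backScan-<m m (j + 0) (suc j) os y (All.++⁻ˡ os rest<m) y<m
               | unrearrange-backScan m (suc j) os y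
  where
  rest<m : All (_< m) (os ∷ʳ y)
  rest<m = count-≡ᵇ-zero (os ∷ʳ y) (All.++⁺ os≤m (y≤m ∷ [])) (suc-injective once)
  y<m : y < m
  y<m = All.head (All.++⁻ʳ os rest<m)
...   | bs , c | c<m , ih | carried≡ rewrite carried≡ | ≡ᵇ-refl m | +-identityʳ j | ≡ᵇ-refl j =
  ≡ᵇ-true⇒≡ o≟m , cong (true ∷_) ih
decisions-backScan m j (o ∷ os) y (o≤m ∷ os≤m) y≤m once | false
  with backScan m (suc j) os y | decisions-backScan m (suc j) os y os≤m y≤m once
...   | bs , .m | refl , ih rewrite ≡ᵇ-refl m =
  refl , trans (decisions-before-position os′ (m<m+n j (z<s {firstSwap bs})))
                (cong (false ∷_) (subst (λ p → decisions m p (suc j) m os′ ≡ bs) (sym (+-suc j (firstSwap bs))) ih))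
  where os′ = proj₁ (unrearrange bs os y)

-- Permutations of positions

snoc : ∀ {A : Set} {k} → Vec A k × A → Vec A (suc k)
snoc = uncurry Vec._∷ʳ_

Rearranging : ℕ → Set₁
Rearranging k = ∀ {A : Set} → Vec A k → A → Vec A k × A

Natural : ∀ {k} → Rearranging k → Set₁
Natural H = ∀ {A B : Set} (h : A → B) as x →
            H (Vec.map h as) (h x) ≡ (Vec.map h (proj₁ (H as x)) , h (proj₂ (H as x)))

rearrangeV : ∀ {k} → Vec Bool k → Rearranging k
rearrangeV []          []       x = [] , x
rearrangeV (true ∷ d)  (a ∷ as) x = map₁ (x ∷_) (rearrangeV d as a)
rearrangeV (false ∷ d) (a ∷ as) x = map₁ (a ∷_) (rearrangeV d as x)

unrearrangeV : ∀ {k} → Vec Bool k → Rearranging k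
unrearrangeV []          []       y = [] , y
unrearrangeV (true ∷ d)  (o ∷ os) y = proj₂ (unrearrangeV d os y) ∷ proj₁ (unrearrangeV d os y) , o
unrearrangeV (false ∷ d) (o ∷ os) y = map₁ (o ∷_) (unrearrangeV d os y)

module _ {A : Set} where

  unrearrangeV-rearrangeV : ∀ {k} (d : Vec Bool k) (as : Vec A k) x →
                            uncurry (unrearrangeV d) (rearrangeV d as x) ≡ (as , x)
  unrearrangeV-rearrangeV []          []       x = refl
  unrearrangeV-rearrangeV (true ∷ d)  (a ∷ as) x rewrite unrearrangeV-rearrangeV d as a = refl
  unrearrangeV-rearrangeV (false ∷ d) (a ∷ as) x rewrite unrearrangeV-rearrangeV d as x = refl

  rearrangeV-unrearrangeV : ∀ {k} (d : Vec Bool k) (os : Vec A k) y →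
                            uncurry (rearrangeV d) (unrearrangeV d os y) ≡ (os , y)
  rearrangeV-unrearrangeV []          []       y = refl
  rearrangeV-unrearrangeV (true ∷ d)  (o ∷ os) y rewrite rearrangeV-unrearrangeV d os y = refl
  rearrangeV-unrearrangeV (false ∷ d) (o ∷ os) y rewrite rearrangeV-unrearrangeV d os y = refl

rearrangeV-natural : ∀ {k} (d : Vec Bool k) → Natural (rearrangeV d)
rearrangeV-natural []          h []       x = refl
rearrangeV-natural (true ∷ d)  h (a ∷ as) x rewrite rearrangeV-natural d h as a = refl
rearrangeV-natural (false ∷ d) h (a ∷ as) x rewrite rearrangeV-natural d h as x = refl

unrearrangeV-natural : ∀ {k} (d : Vec Bool k) → Natural (unrearrangeV d)
unrearrangeV-natural []          h []       y = refl
unrearrangeV-natural (true ∷ d)  h (o ∷ os) y rewrite unrearrangeV-natural d h os y = refl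
unrearrangeV-natural (false ∷ d) h (o ∷ os) y rewrite unrearrangeV-natural d h os y = refl

lookup-∷ʳ-inject₁ : ∀ {A : Set} {k} (v : Vec A k) x i → lookup (v Vec.∷ʳ x) (inject₁ i) ≡ lookup v i
lookup-∷ʳ-inject₁ (a ∷ v) x zero    = refl
lookup-∷ʳ-inject₁ (a ∷ v) x (suc i) = lookup-∷ʳ-inject₁ v x i

lookup-∷ʳ-last : ∀ {A : Set} {k} (v : Vec A k) x → lookup (v Vec.∷ʳ x) (fromℕ k) ≡ x
lookup-∷ʳ-last []      x = refl
lookup-∷ʳ-last (a ∷ v) x = lookup-∷ʳ-last v x

tabulate-∷ʳ : ∀ {A : Set} {k} (f : Fin (suc k) → A) →
              tabulate f ≡ tabulate (f ∘ inject₁) Vec.∷ʳ f (fromℕ k)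
tabulate-∷ʳ {k = zero}  f = refl
tabulate-∷ʳ {k = suc k} f = cong (f zero ∷_) (tabulate-∷ʳ (f ∘ suc))

-- A rearrangement of the entries of a vector followed by one more entry that
-- commutes with relabelling the entries is the action of a permutation of the
-- positions: the one it performs on the positions themselves.
module NaturalRearrangement {k} (F G : Rearranging k) (F-natural : Natural F) (G-natural : Natural G)
  (G-F : ∀ {A : Set} (as : Vec A k) x → uncurry G (F as x) ≡ (as , x))
  (F-G : ∀ {A : Set} (as : Vec A k) x → uncurry F (G as x) ≡ (as , x))
  where

  private
    I : Vec (Fin (suc k)) k
    I = tabulate inject₁

    L : Fin (suc k)
    L = fromℕ k

    table : Rearranging k → Vec (Fin (suc k)) (suc k)
    table H = snoc (H I L)

    table-tabulate : ∀ (H : Rearranging k) → Natural H → ∀ {B : Set} (g : Fin (suc k) → B) →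
                     tabulate (g ∘ lookup (table H)) ≡ snoc (H (tabulate (g ∘ inject₁)) (g L))
    table-tabulate H H-natural g = begin
        tabulate (g ∘ lookup (table H))                  ≡⟨ tabulate-∘ g (lookup (table H)) ⟩
        Vec.map g (tabulate (lookup (table H)))          ≡⟨ cong (Vec.map g) (tabulate∘lookup (table H)) ⟩
        Vec.map g (snoc (H I L))                         ≡⟨ map-∷ʳ g (proj₂ (H I L)) (proj₁ (H I L)) ⟩
        Vec.map g (proj₁ (H I L)) Vec.∷ʳ g (proj₂ (H I L)) ≡⟨ cong snoc (sym (H-natural g I L)) ⟩
        snoc (H (Vec.map g I) (g L))                     ≡⟨ cong (λ as → snoc (H as (g L)))
                                                                  (sym (tabulate-∘ g inject₁)) ⟩
        snoc (H (tabulate (g ∘ inject₁)) (g L))          ∎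
      where open ≡-Reasoning

    table-inverse : ∀ (H H′ : Rearranging k) → Natural H′ →
                    (∀ {A : Set} (as : Vec A k) x → uncurry H′ (H as x) ≡ (as , x)) →
                    ∀ i → lookup (table H) (lookup (table H′) i) ≡ i
    table-inverse H H′ H′-natural H′-H i = begin
        lookup (table H) (lookup (table H′) i)
      ≡⟨ sym (lookup∘tabulate (lookup (table H) ∘ lookup (table H′)) i) ⟩
        lookup (tabulate (lookup (table H) ∘ lookup (table H′))) i
      ≡⟨ cong (λ v → lookup v i) (table-tabulate H′ H′-natural (lookup (table H))) ⟩
        lookup (snoc (H′ (tabulate (lookup (table H) ∘ inject₁)) (lookup (table H) L))) i
      ≡⟨ cong₂ (λ as x → lookup (snoc (H′ as x)) i)
           (trans (tabulate-cong (lookup-∷ʳ-inject₁ (proj₁ (H I L)) (proj₂ (H I L))))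
                  (tabulate∘lookup (proj₁ (H I L))))
           (lookup-∷ʳ-last (proj₁ (H I L)) (proj₂ (H I L))) ⟩
        lookup (snoc (uncurry H′ (H I L))) i
      ≡⟨ cong (λ r → lookup (snoc r) i) (H′-H I L) ⟩
        lookup (I Vec.∷ʳ L) i
      ≡⟨ cong (λ v → lookup v i) (sym (tabulate-∷ʳ (λ j → j))) ⟩
        lookup (Vec.allFin (suc k)) i
      ≡⟨ lookup-allFin i ⟩
        i
      ∎
      where open ≡-Reasoning

  permutationOfPositions : Permutation′ (suc k)
  permutationOfPositions =
    permutation (lookup (table F)) (lookup (table G)) (table-inverse F G G-natural G-F) (table-inverse G F F-natural F-G)

  tabulate-⟨$⟩ʳ : ∀ {B : Set} (g : Fin (suc k) → B) →
    tabulate (g ∘ (permutationOfPositions ⟨$⟩ʳ_)) ≡ snoc (F (tabulate (g ∘ inject₁)) (g (fromℕ k)))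
  tabulate-⟨$⟩ʳ = table-tabulate F F-natural

  tabulate-⟨$⟩ˡ : ∀ {B : Set} (g : Fin (suc k) → B) →
    tabulate (g ∘ (permutationOfPositions ⟨$⟩ˡ_)) ≡ snoc (G (tabulate (g ∘ inject₁)) (g (fromℕ k)))
  tabulate-⟨$⟩ˡ = table-tabulate G G-natural

values : ∀ {n} → Permutation′ n → Vec ℕ n
values π = tabulate (λ i → toℕ (π ⟨$⟩ʳ i))

module _ {k : ℕ} (τ : Permutation′ (suc k)) where

  initValues : Vec ℕ k
  initValues = tabulate (λ i → toℕ (τ ⟨$⟩ʳ inject₁ i))

  lastValue : ℕ
  lastValue = toℕ (τ ⟨$⟩ʳ fromℕ k)

  values-∷ʳ : values τ ≡ initValues Vec.∷ʳ lastValue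
  values-∷ʳ = tabulate-∷ʳ (λ i → toℕ (τ ⟨$⟩ʳ i))

module _ {k : ℕ} (d : Vec Bool k) where

  open NaturalRearrangement (rearrangeV d) (unrearrangeV d) (rearrangeV-natural d) (unrearrangeV-natural d)
                            (unrearrangeV-rearrangeV d) (rearrangeV-unrearrangeV d)

  rearrangement : Permutation′ (suc k)
  rearrangement = permutationOfPositions

  values-rearrangement : ∀ τ →
    values (rearrangement ∘ₚ τ) ≡ snoc (rearrangeV d (initValues τ) (lastValue τ))
  values-rearrangement τ = tabulate-⟨$⟩ʳ (λ i → toℕ (τ ⟨$⟩ʳ i))

  values-unrearrangement : ∀ τ →
    values (flip rearrangement ∘ₚ τ) ≡ snoc (unrearrangeV d (initValues τ) (lastValue τ))
  values-unrearrangement τ = tabulate-⟨$⟩ˡ (λ i → toℕ (τ ⟨$⟩ʳ i))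

values-injective : ∀ {n} (π τ : Permutation′ n) → values π ≡ values τ → π ≈ τ
values-injective π τ eq i = toℕ-injective (begin
  toℕ (π ⟨$⟩ʳ i)            ≡⟨ sym (lookup∘tabulate _ i) ⟩
  lookup (values π) i       ≡⟨ cong (λ v → lookup v i) eq ⟩
  lookup (values τ) i       ≡⟨ lookup∘tabulate _ i ⟩
  toℕ (τ ⟨$⟩ʳ i)            ∎)
  where open ≡-Reasoning

values-cong : ∀ {n} {π τ : Permutation′ n} → π ≈ τ → values π ≡ values τ
values-cong π≈τ = tabulate-cong (cong toℕ ∘ π≈τ)

punchIn-fromℕ : ∀ {n} (i : Fin n) → punchIn (fromℕ n) i ≡ inject₁ i
punchIn-fromℕ zero    = refl
punchIn-fromℕ (suc i) = cong suc (punchIn-fromℕ i)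

extend : ∀ {m} → Permutation′ m → Permutation′ (suc m)
extend {m} σ = insert (fromℕ m) (fromℕ m) σ

restrict : ∀ {m} → Permutation′ (suc m) → Permutation′ m
restrict {m} ρ = remove (fromℕ m) ρ

module _ {m : ℕ} (σ : Permutation′ m) where

  initValues-extend : initValues (extend σ) ≡ values σ
  initValues-extend = tabulate-cong λ i → begin
    toℕ (extend σ ⟨$⟩ʳ inject₁ i)               ≡⟨ cong (toℕ ∘ (extend σ ⟨$⟩ʳ_)) (sym (punchIn-fromℕ i)) ⟩
    toℕ (extend σ ⟨$⟩ʳ punchIn (fromℕ m) i)     ≡⟨ cong toℕ (insert-punchIn (fromℕ m) (fromℕ m) σ i) ⟩
    toℕ (punchIn (fromℕ m) (σ ⟨$⟩ʳ i))          ≡⟨ cong toℕ (punchIn-fromℕ (σ ⟨$⟩ʳ i)) ⟩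
    toℕ (inject₁ (σ ⟨$⟩ʳ i))                    ≡⟨ toℕ-inject₁ (σ ⟨$⟩ʳ i) ⟩
    toℕ (σ ⟨$⟩ʳ i)                              ∎
    where open ≡-Reasoning

  extend-last : extend σ ⟨$⟩ʳ fromℕ m ≡ fromℕ m
  extend-last with fromℕ m ≟ fromℕ m
  ... | yes _   = refl
  ... | no ≢last = contradiction refl ≢last

  lastValue-extend : lastValue (extend σ) ≡ m
  lastValue-extend = trans (cong toℕ extend-last) (toℕ-fromℕ m)

module _ {m : ℕ} (ρ : Permutation′ (suc m)) (fixes-last : ρ ⟨$⟩ʳ fromℕ m ≡ fromℕ m) where

  values-restrict : values (restrict ρ) ≡ initValues ρ
  values-restrict = tabulate-cong λ i → sym (begin
    toℕ (ρ ⟨$⟩ʳ inject₁ i)                              ≡⟨ cong (toℕ ∘ (ρ ⟨$⟩ʳ_)) (sym (punchIn-fromℕ i)) ⟩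
    toℕ (ρ ⟨$⟩ʳ punchIn (fromℕ m) i)                    ≡⟨ cong toℕ (punchIn-permute ρ (fromℕ m) i) ⟩
    toℕ (punchIn (ρ ⟨$⟩ʳ fromℕ m) (restrict ρ ⟨$⟩ʳ i))  ≡⟨ cong (λ j → toℕ (punchIn j (restrict ρ ⟨$⟩ʳ i)))
                                                              fixes-last ⟩
    toℕ (punchIn (fromℕ m) (restrict ρ ⟨$⟩ʳ i))         ≡⟨ cong toℕ (punchIn-fromℕ _) ⟩
    toℕ (inject₁ (restrict ρ ⟨$⟩ʳ i))                   ≡⟨ toℕ-inject₁ _ ⟩
    toℕ (restrict ρ ⟨$⟩ʳ i)                             ∎)
    where open ≡-Reasoning

  extend-restrict : extend (restrict ρ) ≈ ρ
  extend-restrict = subst (λ j → insert (fromℕ m) j (restrict ρ) ≈ ρ) fixes-last (insert-remove (fromℕ m) ρ)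

word : ∀ {n} → Permutation′ n → List ℕ
word π = toList (values π)

toList-tabulate : ∀ {A : Set} {n} (f : Fin n → A) → toList (Vec.tabulate f) ≡ List.tabulate f
toList-tabulate {n = zero}  f = refl
toList-tabulate {n = suc n} f = cong (f zero ∷_) (toList-tabulate (f ∘ suc))

map-filter : ∀ {A B : Set} {P : B → Set} (g : A → B) (P? : Decidable P) xs →
             map g (filter (λ x → P? (g x)) xs) ≡ filter P? (map g xs)
map-filter g P? []       = refl
map-filter g P? (x ∷ xs) with does (P? (g x))
... | true  = cong (g x ∷_) (map-filter g P? xs)
... | false = map-filter g P? xs

shift-positions : ∀ {n} {P : ℕ × ℕ → Set} {P? : Decidable P} j (f : Fin n → ℕ) →
  filter P? (List.tabulate (λ i → (toℕ i + suc j , f i))) ≡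
  filter P? (List.tabulate (λ i → (suc (toℕ i + j) , f i)))
shift-positions {P? = P?} j f = cong (filter P?) (Listₚ.tabulate-cong (λ i → cong (_, f i) (+-suc (toℕ i) j)))

excedance? : Decidable (λ (q : ℕ × ℕ) → proj₁ q < proj₂ q)
excedance? q = proj₁ q <? proj₂ q

nonExcedance? : Decidable (λ (q : ℕ × ℕ) → proj₂ q ≤ proj₁ q)
nonExcedance? q = proj₂ q ≤? proj₁ q

excPairs-tabulate : ∀ {n} j (f : Fin n → ℕ) →
  excPairs j (List.tabulate f) ≡ filter excedance? (List.tabulate (λ i → (toℕ i + j , f i)))
excPairs-tabulate {zero}  j f = refl
excPairs-tabulate {suc n} j f
  with j <? f zero | trans (excPairs-tabulate (suc j) (f ∘ suc)) (shift-positions j (f ∘ suc))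
... | yes j<v | rest = trans (excPairs-exc (List.tabulate (f ∘ suc)) j<v)
                             (trans (cong ((j , f zero) ∷_) rest) (sym (filter-accept excedance? j<v)))
... | no  j≮v | rest = trans (excPairs-nexc (List.tabulate (f ∘ suc)) (≮⇒≥ j≮v))
                             (trans rest (sym (filter-reject excedance? j≮v)))

nexcPairs-tabulate : ∀ {n} j (f : Fin n → ℕ) →
  nexcPairs j (List.tabulate f) ≡ filter nonExcedance? (List.tabulate (λ i → (toℕ i + j , f i)))
nexcPairs-tabulate {zero}  j f = refl
nexcPairs-tabulate {suc n} j f
  with j <? f zero | trans (nexcPairs-tabulate (suc j) (f ∘ suc)) (shift-positions j (f ∘ suc))
... | yes j<v | rest = trans (nexcPairs-exc (List.tabulate (f ∘ suc)) j<v)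
                             (trans rest (sym (filter-reject nonExcedance? (<⇒≱ j<v))))
... | no  j≮v | rest = trans (nexcPairs-nexc (List.tabulate (f ∘ suc)) (≮⇒≥ j≮v))
                             (trans (cong ((j , f zero) ∷_) rest) (sym (filter-accept nonExcedance? (≮⇒≥ j≮v))))

module _ {n : ℕ} (π : Permutation′ n) where

  private
    f : Fin n → ℕ
    f i = toℕ (π ⟨$⟩ʳ i)

    pair : Fin n → ℕ × ℕ
    pair i = (toℕ i , f i)

    filter-pairs : ∀ {P : ℕ × ℕ → Set} (P? : Decidable P) →
      map pair (filter (λ i → P? (pair i)) (List.allFin n)) ≡ filter P? (List.tabulate (λ i → (toℕ i + 0 , f i)))
    filter-pairs P? = trans (map-filter pair P? (List.allFin n)) (cong (filter P?)
      (trans (map-tabulate (λ i → i) pair) (Listₚ.tabulate-cong λ i → cong (_, f i) (sym (+-identityʳ (toℕ i))))))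

    excFin-pairs : map pair (excFin π) ≡ excPairs 0 (word π)
    excFin-pairs = trans (filter-pairs excedance?)
      (sym (trans (cong (excPairs 0) (toList-tabulate f)) (excPairs-tabulate 0 f)))

    nexcFin-pairs : map pair (nexcFin π) ≡ nexcPairs 0 (word π)
    nexcFin-pairs = trans (filter-pairs nonExcedance?)
      (sym (trans (cong (nexcPairs 0) (toList-tabulate f)) (nexcPairs-tabulate 0 f)))

    map-via-pairs : ∀ (h : ℕ × ℕ → ℕ) {is qs} → map pair is ≡ qs → map (h ∘ pair) is ≡ map h qs
    map-via-pairs h {is} eq = trans (map-∘ is) (cong (map h) eq)

  Exc-word : Exc π ≡ map suc (excPositions 0 (word π))
  Exc-word = trans (map-via-pairs (suc ∘ proj₁) excFin-pairs) (map-∘ (excPairs 0 (word π)))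

  EXCL-word : EXCL π ≡ map suc (excLetters 0 (word π))
  EXCL-word = trans (map-via-pairs (suc ∘ proj₂) excFin-pairs) (map-∘ (excPairs 0 (word π)))

  NExc-word : NExc π ≡ map suc (nexcPositions 0 (word π))
  NExc-word = trans (map-via-pairs (suc ∘ proj₁) nexcFin-pairs) (map-∘ (nexcPairs 0 (word π)))

  NEXCL-word : NEXCL π ≡ map suc (nexcLetters 0 (word π))
  NEXCL-word = trans (map-via-pairs (suc ∘ proj₂) nexcFin-pairs) (map-∘ (nexcPairs 0 (word π)))

  exc-word : exc π ≡ excCount (word π)
  exc-word = trans (cong length (map-via-pairs (suc ∘ proj₁) excFin-pairs))
                   (length-map (suc ∘ proj₁) (excPairs 0 (word π)))

  den-word : den π ≡ denᵂ (word π)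
  den-word = begin
    sum (Exc π) + inv (EXCL π) + inv (NEXCL π)
      ≡⟨ cong₂ _+_ (cong₂ _+_ (cong sum Exc-word) (trans (cong inv EXCL-word) (inv-map-suc (excLetters 0 w))))
                   (trans (cong inv NEXCL-word) (inv-map-suc (nexcLetters 0 w))) ⟩
    sum (map suc (excPositions 0 w)) + inv (excLetters 0 w) + inv (nexcLetters 0 w)
      ≡⟨ +-assoc (sum (map suc (excPositions 0 w))) _ _ ⟩
    denᵂ w ∎
    where
    open ≡-Reasoning
    w = word π

private
  module ∑ = FinSum +-0-commutativeMonoid

count-toList-tabulate : ∀ {n} p (g : Fin n → ℕ) →
                        count p (toList (Vec.tabulate g)) ≡ ∑.sum (λ i → iverson (p (g i)))
count-toList-tabulate {zero}  p g = refl
count-toList-tabulate {suc n} p g = cong (iverson (p (g zero)) +_) (count-toList-tabulate p (g ∘ suc))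

sum-below : ∀ n z → z ≤ n → ∑.sum (λ (j : Fin n) → iverson (toℕ j <ᵇ z)) ≡ z
sum-below zero    zero    _           = refl
sum-below (suc n) zero    _           = ∑.sum-replicate-zero n
sum-below (suc n) (suc z) (s≤s z≤n′) = cong suc (sum-below n z z≤n′)

permWord : ∀ {n} (π : Permutation′ n) → IsPermWord (word π)
permWord {n} π z z≤len = begin
    count (_<ᵇ z) (word π)
  ≡⟨ count-toList-tabulate (_<ᵇ z) (λ i → toℕ (π ⟨$⟩ʳ i)) ⟩
    ∑.sum (λ i → iverson (toℕ (π ⟨$⟩ʳ i) <ᵇ z))
  ≡⟨ sym (∑.sum-permute (λ j → iverson (toℕ j <ᵇ z)) π) ⟩
    ∑.sum {n} (λ j → iverson (toℕ j <ᵇ z))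
  ≡⟨ sum-below n z (subst (z ≤_) (length-toList (values π)) z≤len) ⟩
    z
  ∎
  where open ≡-Reasoning

All-word : ∀ {n} (π : Permutation′ n) → All (_< n) (word π)
All-word π = subst (All _) (sym (toList-tabulate _)) (All.tabulate⁺ (λ i → toℕ<n (π ⟨$⟩ʳ i)))

word-∷ʳ : ∀ {k} (τ : Permutation′ (suc k)) → word τ ≡ toList (initValues τ) ∷ʳ lastValue τ
word-∷ʳ τ = trans (cong toList (values-∷ʳ τ)) (toList-∷ʳ (lastValue τ) (initValues τ))

count-max-word : ∀ {k} (τ : Permutation′ (suc k)) → count (_≡ᵇ k) (word τ) ≡ 1
count-max-word {k} τ =
  permWord-count-≡ᵇ {word τ} (permWord τ) {k} (subst (k <_) (sym (length-toList (values τ))) ≤-refl)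

word-injective : ∀ {n} (π τ : Permutation′ n) → word π ≡ word τ → π ≈ τ
word-injective π τ eq =
  values-injective π τ (trans (sym (cast-is-id refl (values π))) (toList-injective refl (values π) (values τ) eq))

den-cong : ∀ {n} {π τ : Permutation′ n} → π ≈ τ → den π ≡ den τ
den-cong {π = π} {τ} π≈τ =
  trans (den-word π) (trans (cong (denᵂ ∘ toList) (values-cong {π = π} {τ} π≈τ)) (sym (den-word τ)))

-- The bijection

toVec : ∀ k → List Bool → Vec Bool k
toVec zero    _        = []
toVec (suc k) []       = false ∷ toVec k []
toVec (suc k) (b ∷ bs) = b ∷ toVec k bs

toList-toVec : ∀ k bs → length bs ≡ k → toList (toVec k bs) ≡ bs
toList-toVec zero    []       _ = refl
toList-toVec (suc k) (b ∷ bs) n≡k = cong (b ∷_) (toList-toVec k bs (suc-injective n≡k))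

toList-unrearrangeV : ∀ {A : Set} {k} (d : Vec Bool k) (os : Vec A k) y →
  (toList (proj₁ (unrearrangeV d os y)) , proj₂ (unrearrangeV d os y)) ≡ unrearrange (toList d) (toList os) y
toList-unrearrangeV []          []       y = refl
toList-unrearrangeV (true ∷ d)  (o ∷ os) y rewrite sym (toList-unrearrangeV d os y) = refl
toList-unrearrangeV (false ∷ d) (o ∷ os) y rewrite sym (toList-unrearrangeV d os y) = refl

toList-rearrangeV : ∀ m p {k} j x (v : Vec ℕ k) →
  let r = rearrangeV (toVec k (decisions m p j x (toList v))) v x in
  (toList (proj₁ r) , proj₂ r) ≡ scan m p j x (toList v)
toList-rearrangeV m p j x []      = refl
toList-rearrangeV m p j x (a ∷ v) with decision m p j x a
... | true  = cong (map₁ (x ∷_)) (toList-rearrangeV m p (suc j) a v)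
... | false = cong (map₁ (a ∷_)) (toList-rearrangeV m p (suc j) x v)

length-backScan : ∀ m j os y → length (proj₁ (backScan m j os y)) ≡ length os
length-backScan m j []       y = refl
length-backScan m j (o ∷ os) y = cong suc (length-backScan m (suc j) os y)

firstSwap-≤ : ∀ bs → firstSwap bs ≤ length bs
firstSwap-≤ []           = z≤n
firstSwap-≤ (true ∷ bs)  = z≤n
firstSwap-≤ (false ∷ bs) = s≤s (firstSwap-≤ bs)

injective⇒surjective : ∀ {n} (f : Fin n → Fin n) → (∀ {i j} → f i ≡ f j → i ≡ j) →
                       ∀ y → ∃ λ x → f x ≡ y
injective⇒surjective {suc n} f f-inj y with any? (λ x → f x ≟ y)
... | yes hit = hit
... | no miss = contradiction (injective⇒≤ punchOut-inj) (<-irrefl refl)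
  where
  missed : ∀ x → y ≢ f x
  missed x y≡fx = miss (x , sym y≡fx)
  punchOut-inj : ∀ {i j} → punchOut (missed i) ≡ punchOut (missed j) → i ≡ j
  punchOut-inj {i} {j} = f-inj ∘ punchOut-injective (missed i) (missed j)

∈-insert : ∀ {i z : ℕ} A B → (i ∈ A ++ z ∷ B) ⇔ (i ∈ A ++ B ⊎ i ≡ z)
∈-insert {i} {z} A B = mk⇔ to from
  where
  to : i ∈ A ++ z ∷ B → i ∈ A ++ B ⊎ i ≡ z
  to i∈ with Any.++⁻ A i∈
  ... | inj₁ i∈A         = inj₁ (Any.++⁺ˡ i∈A)
  ... | inj₂ (here i≡z)  = inj₂ i≡z
  ... | inj₂ (there i∈B) = inj₁ (Any.++⁺ʳ A i∈B)
  from : i ∈ A ++ B ⊎ i ≡ z → i ∈ A ++ z ∷ B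
  from (inj₂ i≡z) = Any.++⁺ʳ A (here i≡z)
  from (inj₁ i∈) with Any.++⁻ A i∈
  ... | inj₁ i∈A = Any.++⁺ˡ i∈A
  ... | inj₂ i∈B = Any.++⁺ʳ A (there i∈B)

module _ {m : ℕ} (σ : Permutation′ m) where

  word-extend : word (extend σ) ≡ word σ ∷ʳ m
  word-extend = trans (word-∷ʳ (extend σ))
    (cong₂ (λ v x → toList v ∷ʳ x) (initValues-extend σ) (lastValue-extend σ))

  schedule : ℕ → Vec Bool m
  schedule p = toVec m (decisions m p 0 m (word σ))

  insertAt : ℕ → Permutation′ (suc m)
  insertAt p = rearrangement (schedule p) ∘ₚ extend σ

  word-insertAt : ∀ p → word (insertAt p) ≡ insertMax m p (word σ)
  word-insertAt p = begin
    toList (values (rearrangement (schedule p) ∘ₚ extend σ))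
      ≡⟨ cong toList (values-rearrangement (schedule p) (extend σ)) ⟩
    toList (snoc (rearrangeV (schedule p) (initValues (extend σ)) (lastValue (extend σ))))
      ≡⟨ cong₂ (λ v x → toList (snoc (rearrangeV (schedule p) v x))) (initValues-extend σ) (lastValue-extend σ) ⟩
    toList (snoc R)
      ≡⟨ toList-∷ʳ (proj₂ R) (proj₁ R) ⟩
    toList (proj₁ R) ∷ʳ proj₂ R
      ≡⟨ cong (uncurry _∷ʳ_) (toList-rearrangeV m p 0 m (values σ)) ⟩
    insertMax m p (word σ)
      ∎
    where
    open ≡-Reasoning
    R = rearrangeV (schedule p) (values σ) m

module Insertion (m : ℕ) where

  positionOf : Permutation′ m → Fin (suc m) → ℕ
  positionOf σ c = position m (word σ) (toℕ c)

  φ : Permutation′ m → Fin (suc m) → Permutation′ (suc m)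
  φ σ c = insertAt σ (positionOf σ c)

  module _ (σ : Permutation′ m) (c : Fin (suc m)) where

    private
      w = word σ
      p = positionOf σ c
      facts = insertMax-position w (toℕ c) (length-toList (values σ)) (All-word σ)
                (subst IsPermWord (word-extend σ) (permWord (extend σ))) (s≤s⁻¹ (toℕ<n c))
      Exc-φ : Exc (φ σ c) ≡ map suc (excPositions 0 (insertMax m p w))
      Exc-φ = trans (Exc-word (φ σ c)) (cong (map suc ∘ excPositions 0) (word-insertAt σ p))

    positionOf-≤ : positionOf σ c ≤ m
    positionOf-≤ = proj₁ facts

    φ-den : den (φ σ c) ≡ den σ + toℕ c
    φ-den = begin
      den (φ σ c)                  ≡⟨ den-word (φ σ c) ⟩
      denᵂ (word (φ σ c))          ≡⟨ cong denᵂ (word-insertAt σ p) ⟩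
      denᵂ (insertMax m p w)       ≡⟨ proj₂ (proj₂ (proj₂ facts)) ⟩
      denᵂ w + toℕ c               ≡⟨ cong (_+ toℕ c) (sym (den-word σ)) ⟩
      den σ + toℕ c                ∎
      where open ≡-Reasoning

    φ-Exc-same : toℕ c ≤ exc σ → ∀ i → (i ∈ Exc (φ σ c)) ⇔ (i ∈ Exc σ)
    φ-Exc-same c≤k i = mk⇔ (subst (i ∈_) same) (subst (i ∈_) (sym same))
      where
      same : Exc (φ σ c) ≡ Exc σ
      same = trans Exc-φ
        (trans (cong (map suc) (proj₁ (proj₂ facts) (subst (toℕ c ≤_) (exc-word σ) c≤k))) (sym (Exc-word σ)))

    φ-Exc-new : exc σ < toℕ c → ∃ λ k → (nth (NExc σ) (toℕ c ∸ exc σ ∸ 1) ≡ just k) ×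
                  (∀ i → (i ∈ Exc (φ σ c)) ⇔ (i ∈ Exc σ ⊎ i ≡ k))
    φ-Exc-new k<c with proj₁ (proj₂ (proj₂ facts)) (subst (_< toℕ c) (exc-word σ) k<c)
    ... | nth≡ , A , B , W≡ , w≡ = suc p , nth-NExc , λ i →
      subst₂ (λ L L′ → (i ∈ L) ⇔ (i ∈ L′ ⊎ i ≡ suc p))
        (sym (trans Exc-φ (trans (cong (map suc) W≡) (map-++ suc A (p ∷ B)))))
        (sym (trans (Exc-word σ) (trans (cong (map suc) w≡) (map-++ suc A B))))
        (∈-insert (map suc A) (map suc B))
      where
      nth-NExc : nth (NExc σ) (toℕ c ∸ exc σ ∸ 1) ≡ just (suc p)
      nth-NExc = trans (cong₂ (λ L k → nth L (toℕ c ∸ k ∸ 1)) (NExc-word σ) (exc-word σ))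
                       (nth-map-suc (nexcPositions 0 w) _ nth≡)

  recoverWord : List ℕ × ℕ → List ℕ
  recoverWord (os , y) = proj₁ (unrearrange (proj₁ (backScan m 0 os y)) os y)

  recoverWord-scan : ∀ p w → All (_< m) w → recoverWord (scan m p 0 m w) ≡ w
  recoverWord-scan p w w<m = begin
    proj₁ (unrearrange (proj₁ (backScan m 0 (proj₁ S) (proj₂ S))) (proj₁ S) (proj₂ S))
      ≡⟨ cong (λ bs → proj₁ (unrearrange bs (proj₁ S) (proj₂ S)))
              (cong proj₁ (backScan-scan m p 0 m w w<m ≤-refl)) ⟩
    proj₁ (unrearrange (decisions m p 0 m w) (proj₁ S) (proj₂ S))
      ≡⟨ cong proj₁ (unrearrange-scan m p 0 m w) ⟩
    w ∎
    where
    open ≡-Reasoning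
    S = scan m p 0 m w

  φ-injective : ∀ σ τ c c′ → φ σ c ≈ φ τ c′ → σ ≈ τ × c ≡ c′
  φ-injective σ τ c c′ φ≈ = σ≈τ , toℕ-injective (+-cancelˡ-≡ (den σ) _ _ dens)
    where
    S = scan m (positionOf σ c) 0 m (word σ)
    S′ = scan m (positionOf τ c′) 0 m (word τ)
    S≡ : S ≡ S′
    S≡ = uncurry (cong₂ _,_) (∷ʳ-injective (proj₁ S) (proj₁ S′) (trans (sym (word-insertAt σ _))
           (trans (cong toList (values-cong {π = φ σ c} {φ τ c′} φ≈)) (word-insertAt τ _))))
    σ≈τ : σ ≈ τ
    σ≈τ = word-injective σ τ (trans (sym (recoverWord-scan _ (word σ) (All-word σ)))
                              (trans (cong recoverWord S≡) (recoverWord-scan _ (word τ) (All-word τ))))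
    dens : den σ + toℕ c ≡ den σ + toℕ c′
    dens = begin
      den σ + toℕ c      ≡⟨ sym (φ-den σ c) ⟩
      den (φ σ c)        ≡⟨ den-cong {π = φ σ c} {φ τ c′} φ≈ ⟩
      den (φ τ c′)       ≡⟨ φ-den τ c′ ⟩
      den τ + toℕ c′     ≡⟨ cong (_+ toℕ c′) (sym (den-cong {π = σ} {τ} σ≈τ)) ⟩
      den σ + toℕ c′     ∎
      where open ≡-Reasoning

  positionFin : Permutation′ m → Fin (suc m) → Fin (suc m)
  positionFin σ c = fromℕ< (s≤s (positionOf-≤ σ c))

  -- φ σ c depends on c only through its position, and den grows by c.
  positionFin-injective : ∀ σ {c c′} → positionFin σ c ≡ positionFin σ c′ → c ≡ c′
  positionFin-injective σ {c} {c′} eq = toℕ-injective (+-cancelˡ-≡ (den σ) _ _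
    (trans (sym (φ-den σ c)) (trans (cong (den ∘ insertAt σ) p≡) (φ-den σ c′))))
    where
    p≡ : positionOf σ c ≡ positionOf σ c′
    p≡ = trans (sym (toℕ-fromℕ< _)) (trans (cong toℕ eq) (toℕ-fromℕ< _))

  module Preimage (π : Permutation′ (suc m)) where

    private
      os = toList (initValues π)
      y = lastValue π
      bs = proj₁ (backScan m 0 os y)
      d = toVec m bs
      length-bs : length bs ≡ m
      length-bs = trans (length-backScan m 0 os y) (length-toList (initValues π))
      π≤m : All (_≤ m) (os ∷ʳ y)
      π≤m = subst (All (_≤ m)) (word-∷ʳ π) (All.map s≤s⁻¹ (All-word π))
      backward = decisions-backScan m 0 os y (All.++⁻ˡ os π≤m) (All.head (All.++⁻ʳ os π≤m))
                   (subst (λ L → count (_≡ᵇ m) L ≡ 1) (word-∷ʳ π) (count-max-word π))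
      ρ = flip (rearrangement d) ∘ₚ π
      U = unrearrangeV d (initValues π) y
      U≡ : (toList (proj₁ U) , proj₂ U) ≡ unrearrange bs os y
      U≡ = trans (toList-unrearrangeV d (initValues π) y)
                 (cong (λ b → unrearrange b os y) (toList-toVec m bs length-bs))
      ρ-split : initValues ρ ≡ proj₁ U × lastValue ρ ≡ proj₂ U
      ρ-split = Vec∷ʳ-injective (initValues ρ) (proj₁ U) (trans (sym (values-∷ʳ ρ)) (values-unrearrangement d π))
      fixes-last : ρ ⟨$⟩ʳ fromℕ m ≡ fromℕ m
      fixes-last = toℕ-injective (begin
        lastValue ρ                ≡⟨ proj₂ ρ-split ⟩
        proj₂ U                    ≡⟨ cong proj₂ U≡ ⟩
        proj₂ (unrearrange bs os y) ≡⟨ unrearrange-backScan m 0 os y ⟩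
        proj₂ (backScan m 0 os y)  ≡⟨ proj₁ backward ⟩
        m                          ≡⟨ sym (toℕ-fromℕ m) ⟩
        toℕ (fromℕ m)              ∎)
        where open ≡-Reasoning

    σ : Permutation′ m
    σ = restrict ρ

    private
      word-σ : word σ ≡ proj₁ (unrearrange bs os y)
      word-σ = trans (cong toList (trans (values-restrict ρ fixes-last) (proj₁ ρ-split))) (cong proj₁ U≡)
      hit = injective⇒surjective (positionFin σ) (positionFin-injective σ)
              (fromℕ< (s≤s (subst (firstSwap bs ≤_) length-bs (firstSwap-≤ bs))))

    c : Fin (suc m)
    c = proj₁ hit

    private
      schedule≡ : schedule σ (positionOf σ c) ≡ d
      schedule≡ = cong (toVec m) (trans (cong₂ (λ q L → decisions m q 0 m L) position≡ word-σ) (proj₂ backward))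
        where
        position≡ : positionOf σ c ≡ firstSwap bs
        position≡ = trans (sym (toℕ-fromℕ< _)) (trans (cong toℕ (proj₂ hit)) (toℕ-fromℕ< _))

    φ≈π : φ σ c ≈ π
    φ≈π i = begin
      extend σ ⟨$⟩ʳ (rearrangement (schedule σ (positionOf σ c)) ⟨$⟩ʳ i)
        ≡⟨ cong (λ e → extend σ ⟨$⟩ʳ (rearrangement e ⟨$⟩ʳ i)) schedule≡ ⟩
      extend σ ⟨$⟩ʳ (rearrangement d ⟨$⟩ʳ i)
        ≡⟨ extend-restrict ρ fixes-last _ ⟩
      π ⟨$⟩ʳ (rearrangement d ⟨$⟩ˡ (rearrangement d ⟨$⟩ʳ i))
        ≡⟨ cong (π ⟨$⟩ʳ_) (inverseˡ (rearrangement d)) ⟩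
      π ⟨$⟩ʳ i
        ∎
      where open ≡-Reasoning

  φ-surjective : ∀ π → ∃₂ λ σ c → φ σ c ≈ π
  φ-surjective π = σ , c , φ≈π
    where open Preimage π

theorem2p1 : (m : ℕ) →
    Σ (Permutation′ m → Fin (suc m) → Permutation′ (suc m)) λ φ →
      (∀ σ τ c c′ → φ σ c ≈ φ τ c′ → σ ≈ τ × c ≡ c′) ×
      (∀ (π : Permutation′ (suc m)) → ∃₂ λ σ c → φ σ c ≈ π) ×
      (∀ σ c →
        (toℕ c ≤ exc σ → ∀ i → (i ∈ Exc (φ σ c)) ⇔ (i ∈ Exc σ)) ×
        (exc σ < toℕ c → ∃ λ k → (nth (NExc σ) (toℕ c ∸ exc σ ∸ 1) ≡ just k) ×
           (∀ i → (i ∈ Exc (φ σ c)) ⇔ (i ∈ Exc σ ⊎ i ≡ k))) ×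
        (den (φ σ c) ≡ den σ + toℕ c))
theorem2p1 m = φ , φ-injective , φ-surjective , λ σ c → φ-Exc-same σ c , φ-Exc-new σ c , φ-den σ c
  where open Insertion m
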